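{- For every positive integer $n$, $P_n(x)=\det(I_n-xA_n)$, equivalently $\det(xI_n-A_n)=x^nP_n(1/x)=\sum_{k=0}^{n}(-1)^{\lfloor 3k/2\rfloor}\binom{\lfloor (n+k)/2\rfloor}{k}x^{n-k}$.
   Context: $A_n$ is the $n\times n$ matrix with $(i,j)$ entry $1$ if $i+j\le n+1$ and $0$ otherwise. $P_n(x)=\sum_{k=0}^{n}(-1)^{\lfloor 3k/2\rfloor}\binom{\lfloor (n+k)/2\rfloor}{k}x^k$. -}

module Defs where

open import Data.Nat as ℕ using (ℕ; zero; suc; _∸_; _≤?_; _<?_; ⌊_/2⌋)
open import Data.Nat.Combinatorics using (_C_)
open import Data.Integer as ℤ using (ℤ; +_; -_)
open import Data.Fin using (Fin; zero; suc; toℕ; punchIn)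
open import Data.Bool using (if_then_else_)
open import Relation.Nullary.Decidable using (does)
open import Relation.Binary.PropositionalEquality using (_≡_)

-- Polynomials in one variable x over ℤ, represented by their coefficient
-- sequence: p k is the coefficient of x^k.
Poly : Set
Poly = ℕ → ℤ

_≈P_ : Poly → Poly → Set
p ≈P q = ∀ k → p k ≡ q k

sumTo : ℕ → (ℕ → ℤ) → ℤ
sumTo zero    f = f 0
sumTo (suc k) f = sumTo k f ℤ.+ f (suc k)

0P : Poly
0P _ = + 0

constP : ℤ → Poly
constP c zero    = c
constP c (suc _) = + 0

X : Poly
X 1 = + 1
X _ = + 0

infixl 6 _+P_ _-P_
infixl 7 _*P_

_+P_ : Poly → Poly → Poly
(p +P q) k = p k ℤ.+ q k

-P_ : Poly → Poly
(-P p) k = - p k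

_-P_ : Poly → Poly → Poly
p -P q = p +P (-P q)

_*P_ : Poly → Poly → Poly
(p *P q) k = sumTo k (λ i → p i ℤ.* q (k ∸ i))

sgn : ℕ → ℤ
sgn zero          = + 1
sgn (suc zero)    = - (+ 1)
sgn (suc (suc m)) = sgn m

sumFinP : ∀ {n} → (Fin n → Poly) → Poly
sumFinP {zero}  f = 0P
sumFinP {suc n} f = f zero +P sumFinP (λ j → f (suc j))

detP : ∀ n → (Fin n → Fin n → Poly) → Poly
detP zero    M = constP (+ 1)
detP (suc n) M = sumFinP (λ j →
  constP (sgn (toℕ j)) *P M zero j *P detP n (λ i k → M (suc i) (punchIn j k)))

-- A_n (0-indexed): entry (i,j) is 1 iff (i+1)+(j+1) ≤ n+1, i.e. i+j < n.
A : ∀ n → Fin n → Fin n → ℤ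
A n i j = if does (toℕ i ℕ.+ toℕ j <? n) then + 1 else + 0

I : ∀ n → Fin n → Fin n → ℤ
I n i j = if does (toℕ i ℕ.≟ toℕ j) then + 1 else + 0

I-xA : ∀ n → Fin n → Fin n → Poly
I-xA n i j = constP (I n i j) -P X *P constP (A n i j)

xI-A : ∀ n → Fin n → Fin n → Poly
xI-A n i j = X *P constP (I n i j) -P constP (A n i j)

coeff : ℕ → ℕ → ℤ
coeff n k = sgn ⌊ 3 ℕ.* k /2⌋ ℤ.* + (⌊ n ℕ.+ k /2⌋ C k)

P : ℕ → Poly
P n k = if does (k ≤? n) then coeff n k else + 0

Prev : ℕ → Poly
Prev n m = if does (m ≤? n) then coeff n (n ∸ m) else + 0

module Submission where

-- Over any commutative ring, subtracting from each column of a I - b A_n but the last the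
-- next one yields a matrix G_n with a on the diagonal, -a below it and -b on an antidiagonal.
-- Expanding det G_n along its first row, and the resulting minors along their last rows,
-- couples det G_n with the determinant of a companion matrix H_n; eliminating the latter gives
--   det G_{n+4} = (2a² - b²) det G_{n+2} - a⁴ det G_n.
-- By Pascal's rule the coefficients of P_n satisfy this recurrence for (a, b) = (1, x), and the
-- reversed polynomials x^n P_n(1/x) satisfy it for (a, b) = (x, 1).  All these polynomials have
-- degree at most n, so the four initial cases are settled by comparing four coefficients.

open import Defs
open import Algebra.Bundles using (CommutativeRing)
open import Data.Nat using (ℕ; _≤_)

module IntegerCoefficients {c ℓ} (R : CommutativeRing c ℓ) where

  open import Data.Nat as ℕ using (ℕ; zero; suc)
  import Data.Nat.Properties as ℕ
  open import Data.Integer as ℤ using (ℤ; +_; -[1+_]; _⊖_; _◃_; sign; ∣_∣)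
  import Data.Integer.Properties as ℤ
  open import Data.Sign as Sign using (Sign)
  open import Data.Maybe using (Maybe; just; nothing)
  open import Relation.Nullary using (yes; no)
  import Relation.Binary.PropositionalEquality as ≡
  open CommutativeRing R
  open import Algebra.Properties.Ring ring using (-0#≈0#; -‿involutive; -‿+-comm; -1*x≈-x)
  open import Algebra.Properties.Semiring.Mult.TCOptimised semiring using (_×_; ×-homo-+; ×1-homo-*)
  open import Algebra.Solver.Ring.AlmostCommutativeRing
    using (fromCommutativeRing; _-Raw-AlmostCommutative⟶_)
  open import Relation.Binary.Reasoning.Setoid setoid

  -- The coefficient homomorphism for Algebra.Solver.Ring.  With the TCOptimised multiple,
  -- ⟦ + 0 ⟧ and ⟦ + 1 ⟧ are 0# and 1# definitionally, so :0 and :1 below denote them.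
  ⟦_⟧ : ℤ → Carrier
  ⟦ + n      ⟧ = n × 1#
  ⟦ -[1+ n ] ⟧ = - (suc n × 1#)

  private
    ×1-suc : ∀ n → suc n × 1# ≈ n × 1# + 1#
    ×1-suc n = trans (reflexive (≡.cong (_× 1#) (ℕ.+-comm 1 n))) (×-homo-+ 1# n 1)

    cancel-+1 : ∀ x y → (x + 1#) + - (y + 1#) ≈ x + - y
    cancel-+1 x y = begin
      (x + 1#) + - (y + 1#)    ≈⟨ +-congˡ (sym (-‿+-comm y 1#)) ⟩
      (x + 1#) + (- y + - 1#)  ≈⟨ +-assoc x 1# _ ⟩
      x + (1# + (- y + - 1#))  ≈⟨ +-congˡ (+-congˡ (+-comm (- y) (- 1#))) ⟩
      x + (1# + (- 1# + - y))  ≈⟨ +-congˡ (sym (+-assoc 1# (- 1#) (- y))) ⟩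
      x + ((1# + - 1#) + - y)  ≈⟨ +-congˡ (+-congʳ (-‿inverseʳ 1#)) ⟩
      x + (0# + - y)           ≈⟨ +-congˡ (+-identityˡ (- y)) ⟩
      x + - y                  ∎

    ⊖-homo : ∀ m n → ⟦ m ⊖ n ⟧ ≈ m × 1# + - (n × 1#)
    ⊖-homo zero    zero    = sym (trans (+-identityˡ (- 0#)) -0#≈0#)
    ⊖-homo zero    (suc n) = sym (+-identityˡ _)
    ⊖-homo (suc m) zero    = sym (trans (+-congˡ -0#≈0#) (+-identityʳ _))
    ⊖-homo (suc m) (suc n) = begin
      ⟦ suc m ⊖ suc n ⟧                  ≡⟨ ≡.cong ⟦_⟧ (ℤ.[1+m]⊖[1+n]≡m⊖n m n) ⟩
      ⟦ m ⊖ n ⟧                          ≈⟨ ⊖-homo m n ⟩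
      m × 1# + - (n × 1#)                ≈⟨ cancel-+1 _ _ ⟨
      (m × 1# + 1#) + - (n × 1# + 1#)    ≈⟨ +-cong (×1-suc m) (-‿cong (×1-suc n)) ⟨
      suc m × 1# + - (suc n × 1#)        ∎

    +-homo : ∀ x y → ⟦ x ℤ.+ y ⟧ ≈ ⟦ x ⟧ + ⟦ y ⟧
    +-homo (+ m)    (+ n)    = ×-homo-+ 1# m n
    +-homo (+ m)    -[1+ n ] = ⊖-homo m (suc n)
    +-homo -[1+ m ] (+ n)    = trans (⊖-homo n (suc m)) (+-comm _ _)
    +-homo -[1+ m ] -[1+ n ] = begin
      - (suc (suc (m ℕ.+ n)) × 1#)         ≡⟨ ≡.cong (λ k → - (suc k × 1#)) (ℕ.+-suc m n) ⟨
      - ((suc m ℕ.+ suc n) × 1#)           ≈⟨ -‿cong (×-homo-+ 1# (suc m) (suc n)) ⟩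
      - (suc m × 1# + suc n × 1#)          ≈⟨ -‿+-comm _ _ ⟨
      - (suc m × 1#) + - (suc n × 1#)      ∎

    -‿homo : ∀ x → ⟦ ℤ.- x ⟧ ≈ - ⟦ x ⟧
    -‿homo (+ zero)  = sym -0#≈0#
    -‿homo (+ suc n) = refl
    -‿homo -[1+ n ]  = sym (-‿involutive _)

    ⟦_⟧ₛ : Sign → Carrier
    ⟦ Sign.+ ⟧ₛ = 1#
    ⟦ Sign.- ⟧ₛ = - 1#

    ◃-homo : ∀ s n → ⟦ s ◃ n ⟧ ≈ ⟦ s ⟧ₛ * (n × 1#)
    ◃-homo s        zero    = sym (zeroʳ _)
    ◃-homo Sign.+   (suc n) = sym (*-identityˡ _)
    ◃-homo Sign.-   (suc n) = sym (-1*x≈-x _)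

    sign-abs : ∀ x → ⟦ x ⟧ ≈ ⟦ sign x ⟧ₛ * (∣ x ∣ × 1#)
    sign-abs (+ n)    = sym (*-identityˡ _)
    sign-abs -[1+ n ] = sym (-1*x≈-x _)

    sign-homo : ∀ s t → ⟦ s Sign.* t ⟧ₛ ≈ ⟦ s ⟧ₛ * ⟦ t ⟧ₛ
    sign-homo Sign.+ t      = sym (*-identityˡ _)
    sign-homo Sign.- Sign.+ = sym (*-identityʳ _)
    sign-homo Sign.- Sign.- = sym (trans (-1*x≈-x _) (-‿involutive _))

    interchange : ∀ p q r s → (p * q) * (r * s) ≈ (p * r) * (q * s)
    interchange p q r s = begin
      (p * q) * (r * s)  ≈⟨ *-assoc p q _ ⟩
      p * (q * (r * s))  ≈⟨ *-congˡ (sym (*-assoc q r s)) ⟩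
      p * ((q * r) * s)  ≈⟨ *-congˡ (*-congʳ (*-comm q r)) ⟩
      p * ((r * q) * s)  ≈⟨ *-congˡ (*-assoc r q s) ⟩
      p * (r * (q * s))  ≈⟨ sym (*-assoc p r _) ⟩
      (p * r) * (q * s)  ∎

    *-homo : ∀ x y → ⟦ x ℤ.* y ⟧ ≈ ⟦ x ⟧ * ⟦ y ⟧
    *-homo x y = begin
      ⟦ (sign x Sign.* sign y) ◃ (∣ x ∣ ℕ.* ∣ y ∣) ⟧
        ≈⟨ ◃-homo (sign x Sign.* sign y) (∣ x ∣ ℕ.* ∣ y ∣) ⟩
      ⟦ sign x Sign.* sign y ⟧ₛ * ((∣ x ∣ ℕ.* ∣ y ∣) × 1#)
        ≈⟨ *-cong (sign-homo (sign x) (sign y)) (×1-homo-* ∣ x ∣ ∣ y ∣) ⟩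
      (⟦ sign x ⟧ₛ * ⟦ sign y ⟧ₛ) * ((∣ x ∣ × 1#) * (∣ y ∣ × 1#))
        ≈⟨ interchange _ _ _ _ ⟩
      (⟦ sign x ⟧ₛ * (∣ x ∣ × 1#)) * (⟦ sign y ⟧ₛ * (∣ y ∣ × 1#))
        ≈⟨ *-cong (sign-abs x) (sign-abs y) ⟨
      ⟦ x ⟧ * ⟦ y ⟧ ∎

    homomorphism : ℤ.+-*-rawRing -Raw-AlmostCommutative⟶ fromCommutativeRing R
    homomorphism = record
      { ⟦_⟧ = ⟦_⟧ ; +-homo = +-homo ; *-homo = *-homo ; -‿homo = -‿homo
      ; 0-homo = refl ; 1-homo = refl }

    ⟦⟧-equal? : ∀ x y → Maybe (⟦ x ⟧ ≈ ⟦ y ⟧)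
    ⟦⟧-equal? x y with x ℤ.≟ y
    ... | yes ≡.refl = just refl
    ... | no _       = nothing

  open import Algebra.Solver.Ring ℤ.+-*-rawRing (fromCommutativeRing R) homomorphism ⟦⟧-equal? public
    using (Polynomial; solve; _:=_; _:+_; _:*_; :-_; _:-_; con)

  :0 :1 : ∀ {n} → Polynomial n
  :0 = con (+ 0)
  :1 = con (+ 1)

module FinPunching where

  open import Data.Nat using (ℕ; suc)
  open import Data.Fin using (Fin; zero; suc; toℕ; punchIn; inject₁; pinch)
  open import Data.Fin.Properties using (toℕ-inject₁)
  open import Data.Nat.Properties using (1+n≢n)
  open import Data.Product using (_×_; _,_)
  open import Data.Sum using (_⊎_; inj₁; inj₂)
  open import Relation.Binary.PropositionalEquality

  -- punchOut without the proof of k ≢ j; its value at j = k is irrelevant.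
  punchOut′ : ∀ {n} → Fin (suc (suc n)) → Fin (suc (suc n)) → Fin (suc n)
  punchOut′ zero    zero    = zero
  punchOut′ zero    (suc j) = j
  punchOut′ (suc k) zero    = zero
  punchOut′ {ℕ.zero} (suc k) (suc j) = zero
  punchOut′ {suc n}  (suc k) (suc j) = suc (punchOut′ k j)

  punchOut′-punchIn : ∀ {n} (k : Fin (suc (suc n))) l → punchOut′ k (punchIn k l) ≡ l
  punchOut′-punchIn zero    l       = refl
  punchOut′-punchIn (suc k) zero    = refl
  punchOut′-punchIn {suc n} (suc k) (suc l) = cong suc (punchOut′-punchIn k l)

  punchIn-punchOut′ : ∀ {n} (j : Fin (suc (suc n))) l →
                      punchIn (punchIn j l) (punchOut′ (punchIn j l) j) ≡ j
  punchIn-punchOut′ zero    l       = refl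
  punchIn-punchOut′ (suc j) zero    = refl
  punchIn-punchOut′ {suc n} (suc j) (suc l) = cong suc (punchIn-punchOut′ j l)

  punchIn-punchIn-swap : ∀ {n} (j : Fin (suc (suc n))) l (x : Fin n) →
    punchIn (punchIn j l) (punchIn (punchOut′ (punchIn j l) j) x) ≡ punchIn j (punchIn l x)
  punchIn-punchIn-swap zero    l       x       = refl
  punchIn-punchIn-swap (suc j) zero    x       = refl
  punchIn-punchIn-swap {suc n} (suc j) (suc l) zero    = refl
  punchIn-punchIn-swap {suc n} (suc j) (suc l) (suc x) = cong suc (punchIn-punchIn-swap j l x)

  punchIn-inject₁-self : ∀ {n} (c : Fin n) → punchIn (inject₁ c) c ≡ suc c
  punchIn-inject₁-self zero    = refl
  punchIn-inject₁-self (suc c) = cong suc (punchIn-inject₁-self c)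

  punchIn-inject₁-pinch : ∀ {n} (c : Fin (suc n)) (i : Fin n) →
    punchIn (punchIn (inject₁ c) (punchIn c i)) (inject₁ (pinch i c)) ≡ inject₁ c
  punchIn-inject₁-pinch zero    zero    = refl
  punchIn-inject₁-pinch zero    (suc i) = refl
  punchIn-inject₁-pinch (suc c) zero    = refl
  punchIn-inject₁-pinch (suc c) (suc i) = cong suc (punchIn-inject₁-pinch c i)

  punchIn-suc-pinch : ∀ {n} (c : Fin (suc n)) (i : Fin n) →
    punchIn (punchIn (inject₁ c) (punchIn c i)) (suc (pinch i c)) ≡ suc c
  punchIn-suc-pinch zero    zero    = refl
  punchIn-suc-pinch zero    (suc i) = refl
  punchIn-suc-pinch (suc c) zero    = refl
  punchIn-suc-pinch (suc c) (suc i) = cong suc (punchIn-suc-pinch c i)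

  punchIn-adjacent : ∀ {n} (c k : Fin (suc n)) →
    punchIn (inject₁ c) k ≡ punchIn (suc c) k ⊎
    (punchIn (inject₁ c) k ≡ suc c × punchIn (suc c) k ≡ inject₁ c)
  punchIn-adjacent zero    zero    = inj₂ (refl , refl)
  punchIn-adjacent zero    (suc k) = inj₁ refl
  punchIn-adjacent {suc n} (suc c) zero = inj₁ refl
  punchIn-adjacent {suc n} (suc c) (suc k) with punchIn-adjacent c k
  ... | inj₁ eq         = inj₁ (cong suc eq)
  ... | inj₂ (eq , eq′) = inj₂ (cong suc eq , cong suc eq′)

  suc≢inject₁ : ∀ {n} (c : Fin n) → suc c ≢ inject₁ c
  suc≢inject₁ c eq = 1+n≢n (trans (cong toℕ eq) (toℕ-inject₁ c))

module Determinant {c ℓ} (R : CommutativeRing c ℓ) where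

  open import Data.Nat as ℕ using (ℕ; zero; suc)
  import Data.Nat.Properties as ℕ
  open import Data.Fin using (Fin; zero; suc; toℕ; punchIn; punchOut; inject₁; fromℕ; pinch)
  open import Data.Fin.Properties
    using (punchIn-punchOut; punchIn-injective; punchInᵢ≢i; toℕ-inject₁) renaming (_≟_ to _≟ᶠ_)
  open import Data.Product using (_,_)
  open import Data.Sum using (inj₁; inj₂)
  open import Data.Empty using (⊥-elim)
  open import Function using (_∘_)
  open import Relation.Nullary using (yes; no)
  open import Relation.Binary.PropositionalEquality as ≡ using (_≡_; _≢_)
  open CommutativeRing R hiding (zero)
  open import Algebra.Properties.Ring ring using (-‿involutive; -1*x≈-x; -‿distribˡ-*; +-cancelʳ)
  open import Algebra.Properties.Semiring.Sum semiring public
    using (sum; sum-cong-≋; sum-replicate-zero; sum-remove; ∑-distrib-+; ∑-comm; *-distribˡ-sum)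
  open import Relation.Binary.Reasoning.Setoid setoid
  open IntegerCoefficients R
  open FinPunching

  Matrix : ℕ → Set c
  Matrix n = Fin n → Fin n → Carrier

  sign : ℕ → Carrier
  sign zero          = 1#
  sign (suc zero)    = - 1#
  sign (suc (suc m)) = sign m

  minor : ∀ {n} → Fin (suc n) → Matrix (suc n) → Matrix n
  minor j M i k = M (suc i) (punchIn j k)

  det : ∀ n → Matrix n → Carrier
  det zero    M = 1#
  det (suc n) M = sum λ j → sign (toℕ j) * M zero j * det n (minor j M)

  laplaceTerm : ∀ n → Matrix (suc n) → Fin (suc n) → Carrier
  laplaceTerm n M j = sign (toℕ j) * M zero j * det n (minor j M)

  sum-zero : ∀ {n} {f : Fin n → Carrier} → (∀ i → f i ≈ 0#) → sum f ≈ 0#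
  sum-zero {n} f≈0 = trans (sum-cong-≋ f≈0) (sum-replicate-zero n)

  sum-single : ∀ {n} (k : Fin n) (f : Fin n → Carrier) → (∀ j → j ≢ k → f j ≈ 0#) → sum f ≈ f k
  sum-single {suc n} k f others≈0 = begin
    sum f                               ≈⟨ sum-remove f ⟩
    f k + sum (λ i → f (punchIn k i))   ≈⟨ +-congˡ (sum-zero λ i → others≈0 (punchIn k i) (punchInᵢ≢i k i)) ⟩
    f k + 0#                            ≈⟨ +-identityʳ _ ⟩
    f k                                 ∎

  sum-pair : ∀ {n} (k : Fin (suc n)) (l : Fin n) (f : Fin (suc n) → Carrier) →
             (∀ j → j ≢ k → j ≢ punchIn k l → f j ≈ 0#) → sum f ≈ f k + f (punchIn k l)
  sum-pair k l f others≈0 = begin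
    sum f                               ≈⟨ sum-remove f ⟩
    f k + sum (λ i → f (punchIn k i))   ≈⟨ +-congˡ (sum-single l _ λ i i≢l →
                                             others≈0 (punchIn k i) (punchInᵢ≢i k i) (i≢l ∘ punchIn-injective k i l)) ⟩
    f k + f (punchIn k l)               ∎

  sign-suc : ∀ m → sign (suc m) ≈ - sign m
  sign-suc zero          = refl
  sign-suc (suc zero)    = sym (-‿involutive 1#)
  sign-suc (suc (suc m)) = sign-suc m

  sign-+ : ∀ m n → sign (m ℕ.+ n) ≈ sign m * sign n
  sign-+ zero          n = sym (*-identityˡ _)
  sign-+ (suc zero)    n = trans (sign-suc n) (sym (-1*x≈-x (sign n)))
  sign-+ (suc (suc m)) n = sign-+ m n

  sign-even : ∀ m → sign (m ℕ.+ m) ≡ 1#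
  sign-even zero    = ≡.refl
  sign-even (suc m) = ≡.trans (≡.cong (λ k → sign (suc k)) (ℕ.+-suc m m)) (sign-even m)

  sign-suc-* : ∀ m → sign (suc m) * sign m ≈ - 1#
  sign-suc-* m = begin
    sign (suc m) * sign m  ≈⟨ sign-+ (suc m) m ⟨
    sign (suc m ℕ.+ m)     ≈⟨ sign-suc (m ℕ.+ m) ⟩
    - sign (m ℕ.+ m)       ≡⟨ ≡.cong -_ (sign-even m) ⟩
    - 1#                   ∎

  sign-swap : ∀ {n} (j : Fin (suc (suc n))) l → let k = punchIn j l in
              sign (toℕ k ℕ.+ toℕ (punchOut′ k j)) ≡ sign (suc (toℕ j ℕ.+ toℕ l))
  sign-swap zero    l       = ≡.cong (λ m → sign (suc m)) (ℕ.+-identityʳ (toℕ l))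
  sign-swap (suc j) zero    = ≡.cong sign (≡.sym (ℕ.+-identityʳ (toℕ j)))
  sign-swap {suc n} (suc j) (suc l) = ≡.trans (≡.cong (λ m → sign (suc m)) (ℕ.+-suc (toℕ k) _))
    (≡.trans (sign-swap j l) (≡.cong sign (≡.sym (ℕ.+-suc (toℕ j) (toℕ l)))))
    where k = punchIn j l

  det-cong : ∀ n {M N : Matrix n} → (∀ i j → M i j ≈ N i j) → det n M ≈ det n N
  det-cong zero    M≈N = refl
  det-cong (suc n) M≈N =
    sum-cong-≋ λ j → *-cong (*-congˡ {sign (toℕ j)} (M≈N zero j)) (det-cong n λ i k → M≈N (suc i) (punchIn j k))

  product-zero₂ : ∀ {s x d} → x ≈ 0# → s * x * d ≈ 0#
  product-zero₂ x≈0 = trans (*-congʳ (trans (*-congˡ x≈0) (zeroʳ _))) (zeroˡ _)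

  product-zero₃ : ∀ {s x d} → d ≈ 0# → s * x * d ≈ 0#
  product-zero₃ d≈0 = trans (*-congˡ d≈0) (zeroʳ _)

  det-column-zero : ∀ n (M : Matrix n) c → (∀ i → M i c ≈ 0#) → det n M ≈ 0#
  det-column-zero (suc n) M c Mc≈0 = sum-zero term≈0
    where
    term≈0 : ∀ j → laplaceTerm n M j ≈ 0#
    term≈0 j with j ≟ᶠ c
    ... | yes ≡.refl = product-zero₂ (Mc≈0 zero)
    ... | no j≢c     = product-zero₃ (det-column-zero n (minor j M) (punchOut j≢c) λ i →
                         trans (reflexive (≡.cong (M (suc i)) (punchIn-punchOut j≢c))) (Mc≈0 (suc i)))

  det-linear-column : ∀ n (M N L : Matrix n) c t →
    (∀ i k → k ≢ c → M i k ≈ N i k) → (∀ i k → k ≢ c → M i k ≈ L i k) →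
    (∀ i → M i c ≈ N i c + t * L i c) → det n M ≈ det n N + t * det n L
  det-linear-column (suc n) M N L c t M≈N M≈L Mc≈ = begin
    sum (term M)                             ≈⟨ sum-cong-≋ term-linear ⟩
    sum (λ j → term N j + t * term L j)      ≈⟨ ∑-distrib-+ (term N) (λ j → t * term L j) ⟩
    sum (term N) + sum (λ j → t * term L j)  ≈⟨ +-congˡ (*-distribˡ-sum t (term L)) ⟨
    sum (term N) + t * sum (term L)          ∎
    where
    term = laplaceTerm n
    pull-t₂ : ∀ s x y d t → s * (x + t * y) * d ≈ s * x * d + t * (s * y * d)
    pull-t₂ = solve 5 (λ s x y d t → s :* (x :+ t :* y) :* d := s :* x :* d :+ t :* (s :* y :* d)) refl
    pull-t₃ : ∀ s x d e t → s * x * (d + t * e) ≈ s * x * d + t * (s * x * e)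
    pull-t₃ = solve 5 (λ s x d e t → s :* x :* (d :+ t :* e) := s :* x :* d :+ t :* (s :* x :* e)) refl
    term-linear : ∀ j → term M j ≈ term N j + t * term L j
    term-linear j with j ≟ᶠ c
    ... | yes ≡.refl = begin
      sign (toℕ j) * M zero j * det n (minor j M)
        ≈⟨ *-congʳ (*-congˡ (Mc≈ zero)) ⟩
      sign (toℕ j) * (N zero j + t * L zero j) * det n (minor j M)
        ≈⟨ pull-t₂ _ _ _ _ t ⟩
      sign (toℕ j) * N zero j * det n (minor j M) + t * (sign (toℕ j) * L zero j * det n (minor j M))
        ≈⟨ +-cong (*-congˡ (det-cong n λ i k → M≈N (suc i) (punchIn j k) (punchInᵢ≢i j k)))
                  (*-congˡ (*-congˡ (det-cong n λ i k → M≈L (suc i) (punchIn j k) (punchInᵢ≢i j k)))) ⟩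
      term N j + t * term L j ∎
    ... | no j≢c = begin
      sign (toℕ j) * M zero j * det n (minor j M)
        ≈⟨ *-congˡ (det-linear-column n (minor j M) (minor j N) (minor j L) (punchOut j≢c) t
             (λ i k k≢ → M≈N (suc i) (punchIn j k) (avoids-c k k≢))
             (λ i k k≢ → M≈L (suc i) (punchIn j k) (avoids-c k k≢))
             (λ i → ≡.subst (λ x → M (suc i) x ≈ N (suc i) x + t * L (suc i) x)
                             (≡.sym (punchIn-punchOut j≢c)) (Mc≈ (suc i)))) ⟩
      sign (toℕ j) * M zero j * (det n (minor j N) + t * det n (minor j L))
        ≈⟨ pull-t₃ _ _ _ _ t ⟩
      sign (toℕ j) * M zero j * det n (minor j N) + t * (sign (toℕ j) * M zero j * det n (minor j L))
        ≈⟨ +-cong (*-congʳ (*-congˡ (M≈N zero j j≢c))) (*-congˡ (*-congʳ (*-congˡ (M≈L zero j j≢c)))) ⟩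
      term N j + t * term L j ∎
      where
      avoids-c : ∀ k → k ≢ punchOut j≢c → punchIn j k ≢ c
      avoids-c k k≢ eq = k≢ (punchIn-injective j k (punchOut j≢c) (≡.trans eq (≡.sym (punchIn-punchOut j≢c))))

  private
    adjacent-terms-cancel : ∀ n (M : Matrix (suc (suc n))) c → (∀ i → M i (inject₁ c) ≈ M i (suc c)) →
      (∀ i → laplaceTerm (suc n) M (punchIn (inject₁ c) (punchIn c i)) ≈ 0#) →
      det (suc (suc n)) M ≈ 0#
    adjacent-terms-cancel n M c Mc≈Mc+1 others≈0 = begin
      sum f
        ≈⟨ sum-remove f ⟩
      f p + sum (λ i → f (punchIn p i))
        ≈⟨ +-congˡ (sum-remove (λ i → f (punchIn p i))) ⟩
      f p + (f (punchIn p c) + sum (λ i → f (punchIn p (punchIn c i))))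
        ≈⟨ +-congˡ (+-cong (reflexive (≡.cong f (punchIn-inject₁-self c))) (sum-zero others≈0)) ⟩
      f p + (f (suc c) + 0#)
        ≈⟨ +-congˡ (trans (+-identityʳ _) opposite) ⟩
      f p + - f p
        ≈⟨ -‿inverseʳ (f p) ⟩
      0# ∎
      where
      p = inject₁ c
      f = laplaceTerm (suc n) M
      same-minor : ∀ i k → M (suc i) (punchIn p k) ≈ M (suc i) (punchIn (suc c) k)
      same-minor i k with punchIn-adjacent c k
      ... | inj₁ eq = reflexive (≡.cong (M (suc i)) eq)
      ... | inj₂ (eq , eq′) = trans (reflexive (≡.cong (M (suc i)) eq))
                                (trans (sym (Mc≈Mc+1 (suc i))) (reflexive (≡.cong (M (suc i)) (≡.sym eq′))))
      opposite : f (suc c) ≈ - f p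
      opposite = begin
        sign (suc (toℕ c)) * M zero (suc c) * det (suc n) (minor (suc c) M)
          ≈⟨ *-cong (*-cong (sign-suc (toℕ c)) (sym (Mc≈Mc+1 zero))) (sym (det-cong (suc n) same-minor)) ⟩
        - sign (toℕ c) * M zero p * det (suc n) (minor p M)
          ≈⟨ trans (*-congʳ (sym (-‿distribˡ-* _ _))) (sym (-‿distribˡ-* _ _)) ⟩
        - (sign (toℕ c) * M zero p * det (suc n) (minor p M))
          ≡⟨ ≡.cong (λ m → - (sign m * M zero p * det (suc n) (minor p M))) (toℕ-inject₁ c) ⟨
        - f p ∎

  det-adjacent-columns : ∀ n (M : Matrix (suc (suc n))) c → (∀ i → M i (inject₁ c) ≈ M i (suc c)) →
                         det (suc (suc n)) M ≈ 0#
  det-adjacent-columns zero    M c Mc≈Mc+1 = adjacent-terms-cancel zero M c Mc≈Mc+1 λ ()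
  det-adjacent-columns (suc n) M c Mc≈Mc+1 = adjacent-terms-cancel (suc n) M c Mc≈Mc+1 λ i →
    product-zero₃ (det-adjacent-columns n (minor (punchIn (inject₁ c) (punchIn c i)) M) (pinch i c) λ r →
      trans (reflexive (≡.cong (M (suc r)) (punchIn-inject₁-pinch c i)))
            (trans (Mc≈Mc+1 (suc r)) (reflexive (≡.cong (M (suc r)) (≡.sym (punchIn-suc-pinch c i))))))

  det-add-next-column : ∀ n (M M′ : Matrix (suc (suc n))) c t →
    (∀ i k → k ≢ inject₁ c → M′ i k ≈ M i k) →
    (∀ i → M′ i (inject₁ c) ≈ M i (inject₁ c) + t * M i (suc c)) →
    det (suc (suc n)) M′ ≈ det (suc (suc n)) M
  det-add-next-column n M M′ c t M′≈M M′c≈ = begin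
    det _ M′              ≈⟨ det-linear-column (suc (suc n)) M′ M L p t M′≈M M′≈L M′p≈ ⟩
    det _ M + t * det _ L ≈⟨ +-congˡ (trans (*-congˡ (det-adjacent-columns n L c L-adjacent)) (zeroʳ t)) ⟩
    det _ M + 0#          ≈⟨ +-identityʳ _ ⟩
    det _ M               ∎
    where
    p = inject₁ c
    -- det M′ = det M + t det L by linearity in column p, and L repeats column p + 1 at p
    next : Fin (suc (suc n)) → Fin (suc (suc n))
    next k with k ≟ᶠ p
    ... | yes _ = suc c
    ... | no _  = k
    next-p : next p ≡ suc c
    next-p with p ≟ᶠ p
    ... | yes _   = ≡.refl
    ... | no p≢p = ⊥-elim (p≢p ≡.refl)
    next-other : ∀ k → k ≢ p → next k ≡ k
    next-other k k≢p with k ≟ᶠ p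
    ... | yes k≡p = ⊥-elim (k≢p k≡p)
    ... | no _    = ≡.refl
    L : Matrix (suc (suc n))
    L i k = M i (next k)
    M′≈L : ∀ i k → k ≢ p → M′ i k ≈ L i k
    M′≈L i k k≢p = trans (M′≈M i k k≢p) (reflexive (≡.cong (M i) (≡.sym (next-other k k≢p))))
    M′p≈ : ∀ i → M′ i p ≈ M i p + t * L i p
    M′p≈ i = trans (M′c≈ i) (+-congˡ (*-congˡ (reflexive (≡.cong (M i) (≡.sym next-p)))))
    L-adjacent : ∀ i → L i p ≈ L i (suc c)
    L-adjacent i = reflexive (≡.trans (≡.cong (M i) next-p) (≡.cong (M i) (≡.sym (next-other (suc c) (suc≢inject₁ c)))))

  ∑-offDiagonal-comm : ∀ {n} (H : Matrix (suc n)) →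
    sum (λ k → sum (λ l → H k (punchIn k l))) ≈ sum (λ j → sum (λ l → H (punchIn j l) j))
  ∑-offDiagonal-comm H = +-cancelʳ (sum λ k → H k k) _ _ (begin
    sum (λ k → sum (λ l → H k (punchIn k l))) + sum (λ k → H k k)
      ≈⟨ ∑-distrib-+ (λ k → sum (λ l → H k (punchIn k l))) (λ k → H k k) ⟨
    sum (λ k → sum (λ l → H k (punchIn k l)) + H k k)
      ≈⟨ sum-cong-≋ (λ k → trans (+-comm _ _) (sym (sum-remove {i = k} (H k)))) ⟩
    sum (λ k → sum (λ j → H k j))
      ≈⟨ ∑-comm H ⟩
    sum (λ j → sum (λ k → H k j))
      ≈⟨ sum-cong-≋ (λ j → trans (sum-remove {i = j} (λ k → H k j)) (+-comm _ _)) ⟩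
    sum (λ j → sum (λ l → H (punchIn j l) j) + H j j)
      ≈⟨ ∑-distrib-+ (λ j → sum (λ l → H (punchIn j l) j)) (λ k → H k k) ⟩
    sum (λ j → sum (λ l → H (punchIn j l) j)) + sum (λ k → H k k) ∎)

  -- Expanding along the first row and, inductively, the minors along their last row gives a sum
  -- over pairs of distinct columns (first-row column, last-row column); it is re-summed with the
  -- last-row column outermost.
  det-expand-last-row : ∀ n (M : Matrix (suc n)) → det (suc n) M ≈
    sum (λ j → sign (n ℕ.+ toℕ j) * M (fromℕ n) j * det n (λ i k → M (inject₁ i) (punchIn j k)))
  det-expand-last-row zero    M = refl
  det-expand-last-row (suc m) M = begin
    sum (λ k → sign (toℕ k) * M zero k * det (suc m) (minor k M))
      ≈⟨ sum-cong-≋ (λ k → *-congˡ {sign (toℕ k) * M zero k} (det-expand-last-row m (minor k M))) ⟩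
    sum (λ k → sign (toℕ k) * M zero k * sum (λ l → sign (m ℕ.+ toℕ l) * last (punchIn k l) * D k l))
      ≈⟨ sum-cong-≋ (λ k → trans (*-distribˡ-sum {suc m} (sign (toℕ k) * M zero k) (lastRowTerm k))
                                  (sum-cong-≋ (regroup k))) ⟩
    sum (λ k → sum (λ l → T k l))
      ≈⟨ sum-cong-≋ (λ k → sum-cong-≋ (λ l → reflexive (≡.cong (T k) (≡.sym (punchOut′-punchIn k l))))) ⟩
    sum (λ k → sum (λ l → H k (punchIn k l)))
      ≈⟨ ∑-offDiagonal-comm H ⟩
    sum (λ j → sum (λ l → H (punchIn j l) j))
      ≈⟨ sum-cong-≋ (λ j → sum-cong-≋ (swap j)) ⟩
    sum (λ j → sum (λ l → sign (suc m ℕ.+ toℕ j) * last j * (sign (toℕ l) * M zero (punchIn j l) * D j l)))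
      ≈⟨ sum-cong-≋ (λ j → *-distribˡ-sum {suc m} (sign (suc m ℕ.+ toℕ j) * last j) (firstRowTerm j)) ⟨
    sum (λ j → sign (suc m ℕ.+ toℕ j) * last j * det (suc m) (λ i k → M (inject₁ i) (punchIn j k))) ∎
    where
    last : Fin (suc (suc m)) → Carrier
    last = M (fromℕ (suc m))
    D : Fin (suc (suc m)) → Fin (suc m) → Carrier
    D k l = det m (λ i x → M (suc (inject₁ i)) (punchIn k (punchIn l x)))
    lastRowTerm firstRowTerm : Fin (suc (suc m)) → Fin (suc m) → Carrier
    lastRowTerm k l = sign (m ℕ.+ toℕ l) * last (punchIn k l) * D k l
    firstRowTerm j l = sign (toℕ l) * M zero (punchIn j l) * D j l
    T : Fin (suc (suc m)) → Fin (suc m) → Carrier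
    T k l = sign m * sign (toℕ k ℕ.+ toℕ l) * (M zero k * (last (punchIn k l) * D k l))
    H : Matrix (suc (suc m))
    H k j = T k (punchOut′ k j)
    regroup : ∀ k l → sign (toℕ k) * M zero k * (sign (m ℕ.+ toℕ l) * last (punchIn k l) * D k l) ≈ T k l
    regroup k l = begin
      sign (toℕ k) * M zero k * (sign (m ℕ.+ toℕ l) * last (punchIn k l) * D k l)
        ≈⟨ *-congˡ (*-congʳ (*-congʳ (sign-+ m (toℕ l)))) ⟩
      sign (toℕ k) * M zero k * (sign m * sign (toℕ l) * last (punchIn k l) * D k l)
        ≈⟨ solve 6 (λ sk a sm sl b d → sk :* a :* (sm :* sl :* b :* d) := sm :* (sk :* sl) :* (a :* (b :* d)))
                   refl _ _ _ _ _ _ ⟩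
      sign m * (sign (toℕ k) * sign (toℕ l)) * (M zero k * (last (punchIn k l) * D k l))
        ≈⟨ *-congʳ (*-congˡ (sign-+ (toℕ k) (toℕ l))) ⟨
      T k l ∎
    swap : ∀ j l → H (punchIn j l) j ≈
      sign (suc m ℕ.+ toℕ j) * last j * (sign (toℕ l) * M zero (punchIn j l) * D j l)
    swap j l = begin
      sign m * sign (toℕ k ℕ.+ toℕ (punchOut′ k j)) * (M zero k * (last (punchIn k (punchOut′ k j)) * D k (punchOut′ k j)))
        ≈⟨ *-cong (*-congˡ (reflexive (sign-swap j l)))
                  (*-congˡ (*-cong (reflexive (≡.cong last (punchIn-punchOut′ j l)))
                                   (det-cong m λ i x → reflexive (≡.cong (M (suc (inject₁ i))) (punchIn-punchIn-swap j l x))))) ⟩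
      sign m * sign (suc (toℕ j ℕ.+ toℕ l)) * (M zero k * (last j * D j l))
        ≈⟨ *-congʳ sign-split ⟩
      sign (suc m ℕ.+ toℕ j) * sign (toℕ l) * (M zero k * (last j * D j l))
        ≈⟨ solve 5 (λ x sl a b d → x :* sl :* (a :* (b :* d)) := x :* b :* (sl :* a :* d)) refl _ _ _ _ _ ⟩
      sign (suc m ℕ.+ toℕ j) * last j * (sign (toℕ l) * M zero k * D j l) ∎
      where
      k = punchIn j l
      sign-split : sign m * sign (suc (toℕ j ℕ.+ toℕ l)) ≈ sign (suc m ℕ.+ toℕ j) * sign (toℕ l)
      sign-split = begin
        sign m * sign (suc (toℕ j ℕ.+ toℕ l))  ≈⟨ sign-+ m _ ⟨
        sign (m ℕ.+ suc (toℕ j ℕ.+ toℕ l))     ≡⟨ ≡.cong sign (ℕ.+-suc m _) ⟩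
        sign (suc (m ℕ.+ (toℕ j ℕ.+ toℕ l)))   ≡⟨ ≡.cong (λ x → sign (suc x)) (ℕ.+-assoc m (toℕ j) (toℕ l)) ⟨
        sign (suc m ℕ.+ toℕ j ℕ.+ toℕ l)       ≈⟨ sign-+ (suc m ℕ.+ toℕ j) (toℕ l) ⟩
        sign (suc m ℕ.+ toℕ j) * sign (toℕ l)  ∎

module Pencil {c ℓ} (R : CommutativeRing c ℓ) (a b : CommutativeRing.Carrier R) where

  open import Data.Nat as ℕ using (ℕ; zero; suc; _≟_; _<?_)
  import Data.Nat.Properties as ℕ
  open import Data.Fin using (Fin; zero; suc; toℕ; fromℕ; fromℕ<; inject₁; punchIn; punchOut)
  open import Data.Fin.Properties using (toℕ-fromℕ; toℕ-fromℕ<; toℕ-inject₁; toℕ<n; toℕ-injective; punchIn-punchOut)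
  open import Relation.Binary.Definitions using (tri<; tri≈; tri>)
  open import Relation.Nullary.Negation using (contradiction)
  open import Data.Bool using (if_then_else_)
  open import Data.Integer using (+_)
  open import Function using (_∘_)
  open import Relation.Nullary using (Dec; does; ¬_)
  open import Relation.Nullary.Decidable using (dec-true; dec-false)
  open import Relation.Binary.PropositionalEquality as ≡ using (_≡_; _≢_)
  open CommutativeRing R hiding (zero)
  open import Relation.Binary.Reasoning.Setoid setoid
  open Determinant R
  open import Algebra.Properties.Ring ring using (-1*x≈-x)
  open IntegerCoefficients R

  -- For numeral indices x when (m ≟ n) computes, so such entries reduce definitionally.
  infix 9 _when_
  _when_ : ∀ {p} {P : Set p} → Carrier → Dec P → Carrier
  x when P? = if does P? then x else 0#

  when-yes : ∀ {p} {P : Set p} x (P? : Dec P) → P → x when P? ≈ x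
  when-yes x P? p rewrite dec-true P? p = refl

  when-no : ∀ {p} {P : Set p} x (P? : Dec P) → ¬ P → x when P? ≈ 0#
  when-no x P? ¬p rewrite dec-false P? ¬p = refl

  matrix : ∀ {n} → (ℕ → ℕ → Carrier) → Matrix n
  matrix f i j = f (toℕ i) (toℕ j)

  pencil : ℕ → ℕ → ℕ → Carrier
  pencil n i j = a when (i ≟ j) + - b when (i ℕ.+ j <? n)

  -- the pencil after subtracting from every column but the last the column following it
  G : ℕ → ℕ → ℕ → Carrier
  G n i j = a when (i ≟ j) + - a when (i ≟ suc j) + - b when (suc (i ℕ.+ j) ≟ n)

  -- G (t + 2) without its first row and last column is, up to the order of summands, H t read as
  -- a (t + 1) × (t + 1) matrix
  H : ℕ → ℕ → ℕ → Carrier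
  H n i j = - a when (i ≟ j) + a when (suc i ≟ j) + - b when (i ℕ.+ j ≟ n)

  detG detH : ℕ → Carrier
  detG n = det n (matrix (G n))
  detH n = det n (matrix (H n))

  G-shift : ∀ n i k → G (suc (suc n)) (suc i) (suc k) ≡ G n i k
  G-shift n i k = ≡.cong (λ m → a when (i ≟ k) + - a when (i ≟ suc k) + - b when (m ≟ n)) (ℕ.+-suc i k)

  H-shift : ∀ n i k → H (suc (suc n)) (suc i) (suc k) ≡ H n i k
  H-shift n i k = ≡.cong (λ m → - a when (i ≟ k) + a when (suc i ≟ k) + - b when (m ≟ suc n)) (ℕ.+-suc i k)

  toℕ-punchIn-fromℕ : ∀ {n} (k : Fin n) → toℕ (punchIn (fromℕ n) k) ≡ toℕ k
  toℕ-punchIn-fromℕ zero    = ≡.refl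
  toℕ-punchIn-fromℕ (suc k) = ≡.cong suc (toℕ-punchIn-fromℕ k)

  toℕ≡⇒≡fromℕ : ∀ {t} (j : Fin (suc t)) → toℕ j ≡ t → j ≡ fromℕ t
  toℕ≡⇒≡fromℕ {t} j eq = toℕ-injective (≡.trans eq (≡.sym (toℕ-fromℕ t)))

  det-matrix-expand-last-row : ∀ t (f : ℕ → ℕ → Carrier) → det (suc t) (matrix f) ≈
    sum (λ j → sign (t ℕ.+ toℕ j) * f t (toℕ j) * det t (λ i k → f (toℕ i) (toℕ (punchIn j k))))
  det-matrix-expand-last-row t f = trans (det-expand-last-row t (matrix f)) (sum-cong-≋ λ j →
    *-cong (*-congˡ {sign (t ℕ.+ toℕ j)} (reflexive (≡.cong (λ r → f r (toℕ j)) (toℕ-fromℕ t))))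
           (det-cong t λ i k → reflexive (≡.cong (λ r → f r (toℕ (punchIn j k))) (toℕ-inject₁ i))))

  det-drop-last : ∀ t (f : ℕ → ℕ → Carrier) →
    det t (λ i k → f (toℕ i) (toℕ (punchIn (fromℕ t) k))) ≈ det t (matrix f)
  det-drop-last t f = det-cong t λ i k → reflexive (≡.cong (f (toℕ i)) (toℕ-punchIn-fromℕ k))

  detG-extended : ∀ t → det (suc t) (matrix (G t)) ≈ a * detG t
  detG-extended t = begin
    det (suc t) (matrix (G t))
      ≈⟨ det-matrix-expand-last-row t (G t) ⟩
    sum f
      ≈⟨ sum-single (fromℕ t) f others≈0 ⟩
    f (fromℕ t)
      ≈⟨ *-cong (*-cong (reflexive (≡.trans (≡.cong (λ m → sign (t ℕ.+ m)) (toℕ-fromℕ t)) (sign-even t))) corner)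
                (det-drop-last t (G t)) ⟩
    1# * a * detG t
      ≈⟨ *-congʳ (*-identityˡ a) ⟩
    a * detG t ∎
    where
    f : Fin (suc t) → Carrier
    f j = sign (t ℕ.+ toℕ j) * G t t (toℕ j) * det t (λ i k → G t (toℕ i) (toℕ (punchIn j k)))
    corner : G t t (toℕ (fromℕ t)) ≈ a
    corner = begin
      G t t (toℕ (fromℕ t))  ≡⟨ ≡.cong (G t t) (toℕ-fromℕ t) ⟩
      G t t t                ≈⟨ +-cong (+-cong (when-yes a (t ≟ t) ≡.refl) (-‿cong (when-no a (t ≟ suc t) (ℕ.<⇒≢ (ℕ.n<1+n t)))))
                                       (-‿cong (when-no b (suc (t ℕ.+ t) ≟ t) (ℕ.m≢1+n+m t ∘ ≡.sym))) ⟩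
      a + - 0# + - 0#        ≈⟨ solve 1 (λ x → x :+ :- :0 :+ :- :0 := x) refl a ⟩
      a                      ∎
    last-column-zero : ∀ (i : Fin t) → G t (toℕ i) t ≈ 0#
    last-column-zero i = begin
      G t (toℕ i) t  ≈⟨ +-cong (+-cong (when-no a (toℕ i ≟ t) (ℕ.<⇒≢ (toℕ<n i)))
                                       (-‿cong (when-no a (toℕ i ≟ suc t) (ℕ.<⇒≢ (ℕ.m<n⇒m<1+n (toℕ<n i))))))
                               (-‿cong (when-no b (suc (toℕ i ℕ.+ t) ≟ t) (ℕ.m≢1+n+m t ∘ ≡.sym))) ⟩
      0# + - 0# + - 0# ≈⟨ solve 0 (:0 :+ :- :0 :+ :- :0 := :0) refl ⟩
      0# ∎
    others≈0 : ∀ j → j ≢ fromℕ t → f j ≈ 0#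
    others≈0 j j≢t = product-zero₃ (det-column-zero t _ (punchOut j≢t) λ i →
      trans (reflexive (≡.cong (λ k → G t (toℕ i) (toℕ k)) (punchIn-punchOut j≢t)))
            (trans (reflexive (≡.cong (G t (toℕ i)) (toℕ-fromℕ t))) (last-column-zero i)))

  H-next≈G : ∀ t i k → H t i (suc k) ≈ G t i k
  H-next≈G t i k = begin
    - a when (i ≟ suc k) + a when (i ≟ k) + - b when (i ℕ.+ suc k ≟ t)
      ≡⟨ ≡.cong (λ m → - a when (i ≟ suc k) + a when (i ≟ k) + - b when (m ≟ t)) (ℕ.+-suc i k) ⟩
    - a when (i ≟ suc k) + a when (i ≟ k) + - b when (suc (i ℕ.+ k) ≟ t)
      ≈⟨ solve 3 (λ x y z → :- x :+ y :+ :- z := y :+ :- x :+ :- z) refl _ _ _ ⟩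
    G t i k ∎

  detH-extended : ∀ t → det (suc t) (matrix (H t)) ≈ sign t * - b * detG t + - a * detH t
  detH-extended zero = solve 2 (λ a b → :1 :* (:- a :+ :0 :+ :- b) :* :1 :+ :0
                                     := :1 :* :- b :* :1 :+ :- a :* :1) refl a b
  detH-extended t@(suc t′) = begin
    det (suc t) (matrix (H t))
      ≈⟨ det-matrix-expand-last-row t (H t) ⟩
    sum f
      ≈⟨ sum-pair zero (fromℕ t′) f others≈0 ⟩
    f zero + f (fromℕ t)
      ≈⟨ +-cong (*-cong (*-cong (reflexive (≡.cong sign (ℕ.+-identityʳ t))) first)
                        (det-cong t λ i k → H-next≈G t (toℕ i) (toℕ k)))
                (*-cong (*-cong (reflexive (≡.trans (≡.cong (λ m → sign (t ℕ.+ m)) (toℕ-fromℕ t)) (sign-even t))) corner)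
                        (det-drop-last t (H t))) ⟩
    sign t * - b * detG t + 1# * - a * detH t
      ≈⟨ +-congˡ (*-congʳ (*-identityˡ (- a))) ⟩
    sign t * - b * detG t + - a * detH t ∎
    where
    f : Fin (suc t) → Carrier
    f j = sign (t ℕ.+ toℕ j) * H t t (toℕ j) * det t (λ i k → H t (toℕ i) (toℕ (punchIn j k)))
    first : H t t 0 ≈ - b
    first = begin
      H t t 0            ≈⟨ +-congˡ (-‿cong (when-yes b (t ℕ.+ 0 ≟ t) (ℕ.+-identityʳ t))) ⟩
      - 0# + 0# + - b    ≈⟨ solve 1 (λ x → :- :0 :+ :0 :+ :- x := :- x) refl b ⟩
      - b                ∎
    corner : H t t (toℕ (fromℕ t)) ≈ - a
    corner = begin
      H t t (toℕ (fromℕ t))  ≡⟨ ≡.cong (H t t) (toℕ-fromℕ t) ⟩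
      H t t t                ≈⟨ +-cong (+-cong (-‿cong (when-yes a (t ≟ t) ≡.refl)) (when-no a (suc t ≟ t) (ℕ.1+n≢n)))
                                       (-‿cong (when-no b (t ℕ.+ t ≟ t) (ℕ.m+1+n≢m t))) ⟩
      - a + 0# + - 0#        ≈⟨ solve 1 (λ x → :- x :+ :0 :+ :- :0 := :- x) refl a ⟩
      - a                    ∎
    others≈0 : ∀ j → j ≢ zero → j ≢ fromℕ t → f j ≈ 0#
    others≈0 zero    j≢0 _   = contradiction ≡.refl j≢0
    others≈0 (suc j) _   j≢t = product-zero₂ (begin
      H t t (suc (toℕ j))  ≈⟨ +-cong (+-cong (-‿cong (when-no a (t ≟ suc (toℕ j)) t≢j+1))
                                             (when-no a (suc t ≟ suc (toℕ j)) (ℕ.<⇒≢ (toℕ<n j) ∘ ≡.sym ∘ ℕ.suc-injective)))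
                                     (-‿cong (when-no b (t ℕ.+ suc (toℕ j) ≟ t) (ℕ.m+1+n≢m t))) ⟩
      - 0# + 0# + - 0#     ≈⟨ solve 0 (:- :0 :+ :0 :+ :- :0 := :0) refl ⟩
      0#                   ∎)
      where
      t≢j+1 : t ≢ suc (toℕ j)
      t≢j+1 = j≢t ∘ ≡.cong suc ∘ toℕ≡⇒≡fromℕ j ∘ ℕ.suc-injective ∘ ≡.sym

  detG-rec : ∀ t → detG (suc (suc t)) ≈ (a * a + - (b * b)) * detG t + sign (suc t) * (a * b) * detH t
  detG-rec t = begin
    det (suc (suc t)) M
      ≈⟨ sum-pair zero (fromℕ t) (laplaceTerm (suc t) M) others≈0 ⟩
    laplaceTerm (suc t) M zero + laplaceTerm (suc t) M (fromℕ (suc t))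
      ≈⟨ +-cong (*-cong (*-congˡ first) (trans (det-cong (suc t) λ i k → reflexive (G-shift t (toℕ i) (toℕ k))) (detG-extended t)))
                (*-cong (*-cong (reflexive (≡.cong (sign ∘ suc) (toℕ-fromℕ t))) last)
                        (trans (det-cong (suc t) λ i k → trans (reflexive (≡.cong (G (suc (suc t)) (suc (toℕ i))) (toℕ-punchIn-fromℕ k)))
                                                               (G-after-first-row (toℕ i) (toℕ k)))
                               (detH-extended t))) ⟩
    1# * a * (a * detG t) + sign (suc t) * - b * (sign t * - b * detG t + - a * detH t)
      ≈⟨ solve 6 (λ a b s′ s d e → :1 :* a :* (a :* d) :+ s′ :* :- b :* (s :* :- b :* d :+ :- a :* e)
                                 := (a :* a :+ s′ :* s :* (b :* b)) :* d :+ s′ :* (a :* b) :* e)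
                 refl a b (sign (suc t)) (sign t) (detG t) (detH t) ⟩
    (a * a + sign (suc t) * sign t * (b * b)) * detG t + sign (suc t) * (a * b) * detH t
      ≈⟨ +-congʳ (*-congʳ (+-congˡ (trans (*-congʳ (sign-suc-* t)) (-1*x≈-x (b * b))))) ⟩
    (a * a + - (b * b)) * detG t + sign (suc t) * (a * b) * detH t ∎
    where
    M = matrix (G (suc (suc t)))
    first : G (suc (suc t)) 0 0 ≈ a
    first = solve 1 (λ x → x :+ :- :0 :+ :- :0 := x) refl a
    last : G (suc (suc t)) 0 (toℕ (fromℕ (suc t))) ≈ - b
    last = begin
      G (suc (suc t)) 0 (toℕ (fromℕ (suc t)))  ≡⟨ ≡.cong (G (suc (suc t)) 0) (toℕ-fromℕ (suc t)) ⟩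
      0# + - 0# + - b when (t ≟ t)              ≈⟨ +-congˡ (-‿cong (when-yes b (t ≟ t) ≡.refl)) ⟩
      0# + - 0# + - b                           ≈⟨ solve 1 (λ x → :0 :+ :- :0 :+ :- x := :- x) refl b ⟩
      - b                                       ∎
    G-after-first-row : ∀ i k → G (suc (suc t)) (suc i) k ≈ H t i k
    G-after-first-row i k = solve 3 (λ x y z → x :+ :- y :+ :- z := :- y :+ x :+ :- z) refl _ _ _
    others≈0 : ∀ j → j ≢ zero → j ≢ fromℕ (suc t) → laplaceTerm (suc t) M j ≈ 0#
    others≈0 zero     j≢0 _ = contradiction ≡.refl j≢0
    others≈0 (suc j′) _ j≢t = product-zero₂ (begin
      0# + - 0# + - b when (toℕ j′ ≟ t)  ≈⟨ +-congˡ (-‿cong (when-no b (toℕ j′ ≟ t) (j≢t ∘ ≡.cong suc ∘ toℕ≡⇒≡fromℕ j′))) ⟩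
      0# + - 0# + - 0#                   ≈⟨ solve 0 (:0 :+ :- :0 :+ :- :0 := :0) refl ⟩
      0#                                 ∎)

  detH-rec : ∀ t → detH (suc (suc t)) ≈ sign t * (a * b) * detG t + a * a * detH t
  detH-rec t = begin
    det (suc (suc t)) M
      ≈⟨ sum-pair zero zero (laplaceTerm (suc t) M) others≈0 ⟩
    laplaceTerm (suc t) M zero + laplaceTerm (suc t) M (suc zero)
      ≈⟨ +-cong (*-congˡ (trans (det-cong (suc t) λ i k → reflexive (H-shift t (toℕ i) (toℕ k))) (detH-extended t)))
                (product-zero₃ (det-column-zero (suc t) (minor (suc zero) M) zero first-column-zero)) ⟩
    1# * (- a + 0# + - 0#) * (sign t * - b * detG t + - a * detH t) + 0#
      ≈⟨ solve 5 (λ a b s d e → :1 :* (:- a :+ :0 :+ :- :0) :* (s :* :- b :* d :+ :- a :* e) :+ :0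
                             := s :* (a :* b) :* d :+ a :* a :* e) refl a b (sign t) (detG t) (detH t) ⟩
    sign t * (a * b) * detG t + a * a * detH t ∎
    where
    M = matrix (H (suc (suc t)))
    first-column-zero : ∀ i → minor (suc zero) M i zero ≈ 0#
    first-column-zero i = begin
      - 0# + 0# + - b when (toℕ i ℕ.+ 0 ≟ suc t)  ≈⟨ +-congˡ (-‿cong (when-no b (toℕ i ℕ.+ 0 ≟ suc t) i+0≢t+1)) ⟩
      - 0# + 0# + - 0#                            ≈⟨ solve 0 (:- :0 :+ :0 :+ :- :0 := :0) refl ⟩
      0#                                          ∎
      where
      i+0≢t+1 : toℕ i ℕ.+ 0 ≢ suc t
      i+0≢t+1 eq = ℕ.<⇒≢ (toℕ<n i) (≡.trans (≡.sym (ℕ.+-identityʳ (toℕ i))) eq)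
    others≈0 : ∀ j → j ≢ zero → j ≢ suc zero → laplaceTerm (suc t) M j ≈ 0#
    others≈0 zero          j≢0 _   = contradiction ≡.refl j≢0
    others≈0 (suc zero)    _   j≢1 = contradiction ≡.refl j≢1
    others≈0 (suc (suc j)) _   _   = product-zero₂ (begin
      - 0# + 0# + - b when (toℕ j ≟ t)  ≈⟨ +-congˡ (-‿cong (when-no b (toℕ j ≟ t) (ℕ.<⇒≢ (toℕ<n j)))) ⟩
      - 0# + 0# + - 0#                  ≈⟨ solve 0 (:- :0 :+ :0 :+ :- :0 := :0) refl ⟩
      0#                                ∎)

  detG-rec₄ : ∀ t → detG (suc (suc (suc (suc t)))) ≈
              (a * a + a * a + - (b * b)) * detG (suc (suc t)) + - (a * a * (a * a) * detG t)
  detG-rec₄ t = begin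
    detG (4+ t)
      ≈⟨ detG-rec (2+ t) ⟩
    (a * a + - (b * b)) * detG (2+ t) + sign (suc t) * (a * b) * detH (2+ t)
      ≈⟨ +-congˡ (*-congˡ (detH-rec t)) ⟩
    (a * a + - (b * b)) * detG (2+ t) + sign (suc t) * (a * b) * (sign t * (a * b) * detG t + a * a * detH t)
      ≈⟨ solve 7 (λ a b s′ s d₀ d₂ e₀ →
                    (a :* a :+ :- (b :* b)) :* d₂ :+ s′ :* (a :* b) :* (s :* (a :* b) :* d₀ :+ a :* a :* e₀)
                 := (a :* a :+ :- (b :* b)) :* d₂ :+ s′ :* s :* (a :* b :* (a :* b) :* d₀) :+ a :* a :* (s′ :* (a :* b) :* e₀))
                 refl a b (sign (suc t)) (sign t) (detG t) (detG (2+ t)) (detH t) ⟩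
    (a * a + - (b * b)) * detG (2+ t) + sign (suc t) * sign t * (a * b * (a * b) * detG t)
                                     + a * a * (sign (suc t) * (a * b) * detH t)
      ≈⟨ +-cong (+-congˡ (*-congʳ (sign-suc-* t))) (*-congˡ detH-term) ⟩
    (a * a + - (b * b)) * detG (2+ t) + - 1# * (a * b * (a * b) * detG t)
                                     + a * a * (detG (2+ t) + - ((a * a + - (b * b)) * detG t))
      ≈⟨ solve 4 (λ a b d₀ d₂ →
                    (a :* a :+ :- (b :* b)) :* d₂ :+ :- :1 :* (a :* b :* (a :* b) :* d₀)
                      :+ a :* a :* (d₂ :+ :- ((a :* a :+ :- (b :* b)) :* d₀))
                 := (a :* a :+ a :* a :+ :- (b :* b)) :* d₂ :+ :- (a :* a :* (a :* a) :* d₀))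
                 refl a b (detG t) (detG (2+ t)) ⟩
    (a * a + a * a + - (b * b)) * detG (2+ t) + - (a * a * (a * a) * detG t) ∎
    where
    2+ 4+ : ℕ → ℕ
    2+ n = suc (suc n)
    4+ n = suc (suc (suc (suc n)))
    detH-term : sign (suc t) * (a * b) * detH t ≈ detG (2+ t) + - ((a * a + - (b * b)) * detG t)
    detH-term = begin
      sign (suc t) * (a * b) * detH t
        ≈⟨ solve 2 (λ x y → x := y :+ x :+ :- y) refl _ _ ⟩
      (a * a + - (b * b)) * detG t + sign (suc t) * (a * b) * detH t + - ((a * a + - (b * b)) * detG t)
        ≈⟨ +-congʳ (detG-rec t) ⟨
      detG (2+ t) + - ((a * a + - (b * b)) * detG t) ∎

  when-<-difference : ∀ y x n → y when (x <? n) + - y when (suc x <? n) ≈ y when (suc x ≟ n)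
  when-<-difference y x n with ℕ.<-cmp (suc x) n
  ... | tri< x+1<n x+1≢n _ = begin
    y when (x <? n) + - y when (suc x <? n)  ≈⟨ +-cong (when-yes y (x <? n) (ℕ.<-trans (ℕ.n<1+n x) x+1<n))
                                                        (-‿cong (when-yes y (suc x <? n) x+1<n)) ⟩
    y + - y                                  ≈⟨ -‿inverseʳ y ⟩
    0#                                       ≈⟨ when-no y (suc x ≟ n) x+1≢n ⟨
    y when (suc x ≟ n)                       ∎
  ... | tri≈ _ x+1≡n _ = begin
    y when (x <? n) + - y when (suc x <? n)  ≈⟨ +-cong (when-yes y (x <? n) (ℕ.≤-reflexive x+1≡n))
                                                        (-‿cong (when-no y (suc x <? n) (ℕ.<-irrefl x+1≡n))) ⟩
    y + - 0#                                 ≈⟨ solve 1 (λ y → y :+ :- :0 := y) refl y ⟩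
    y                                        ≈⟨ when-yes y (suc x ≟ n) x+1≡n ⟨
    y when (suc x ≟ n)                       ∎
  ... | tri> _ x+1≢n n<x+1 = begin
    y when (x <? n) + - y when (suc x <? n)  ≈⟨ +-cong (when-no y (x <? n) (ℕ.≤⇒≯ (ℕ.s≤s⁻¹ n<x+1)))
                                                        (-‿cong (when-no y (suc x <? n) (ℕ.<⇒≯ n<x+1))) ⟩
    0# + - 0#                                ≈⟨ solve 0 (:0 :+ :- :0 := :0) refl ⟩
    0#                                       ≈⟨ when-no y (suc x ≟ n) x+1≢n ⟨
    y when (suc x ≟ n)                       ∎

  staged : ℕ → ℕ → ℕ → ℕ → Carrier
  staged n k i j = if does (j <? k) then pencil n i j + - 1# * pencil n i (suc j) else pencil n i j

  staged-step : ∀ m k → k ℕ.≤ m → let n = suc (suc m) in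
                det n (matrix (staged n (suc k))) ≈ det n (matrix (staged n k))
  staged-step m k k≤m = det-add-next-column m (matrix (staged n k)) (matrix (staged n (suc k))) col (- 1#) other-columns column-k
    where
    n = suc (suc m)
    col : Fin (suc m)
    col = fromℕ< (ℕ.s≤s k≤m)
    toℕ-col : toℕ (inject₁ col) ≡ k
    toℕ-col = ≡.trans (toℕ-inject₁ col) (toℕ-fromℕ< (ℕ.s≤s k≤m))
    other-columns : ∀ i j → j ≢ inject₁ col → staged n (suc k) (toℕ i) (toℕ j) ≈ staged n k (toℕ i) (toℕ j)
    other-columns i j j≢col = reflexive (≡.cong (λ β → if β then p (toℕ j) + - 1# * p (suc (toℕ j)) else p (toℕ j)) (<-suc j≢k))
      where
      p = pencil n (toℕ i)
      j≢k : toℕ j ≢ k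
      j≢k eq = j≢col (toℕ-injective (≡.trans eq (≡.sym toℕ-col)))
      <-suc : toℕ j ≢ k → does (toℕ j <? suc k) ≡ does (toℕ j <? k)
      <-suc j≢k with ℕ.<-cmp (toℕ j) k
      ... | tri< j<k _ _ = ≡.trans (dec-true (toℕ j <? suc k) (ℕ.m<n⇒m<1+n j<k)) (≡.sym (dec-true (toℕ j <? k) j<k))
      ... | tri≈ _ j≡k _ = contradiction j≡k j≢k
      ... | tri> _ _ k<j = ≡.trans (dec-false (toℕ j <? suc k) (ℕ.≤⇒≯ k<j)) (≡.sym (dec-false (toℕ j <? k) (ℕ.<⇒≯ k<j)))
    column-k : ∀ i → staged n (suc k) (toℕ i) (toℕ (inject₁ col)) ≈
                     staged n k (toℕ i) (toℕ (inject₁ col)) + - 1# * staged n k (toℕ i) (toℕ (suc col))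
    column-k i rewrite toℕ-col | toℕ-fromℕ< (ℕ.s≤s k≤m)
                     | dec-true (k <? suc k) (ℕ.n<1+n k) | dec-false (k <? k) (ℕ.<-irrefl ≡.refl)
                     | dec-false (suc k <? k) (ℕ.<⇒≯ (ℕ.n<1+n k)) = refl

  staged-all : ∀ m k → k ℕ.≤ m → det (suc m) (matrix (staged (suc m) k)) ≈ det (suc m) (matrix (pencil (suc m)))
  staged-all m       zero    _         = refl
  staged-all (suc m) (suc k) (ℕ.s≤s k≤m) = trans (staged-step m k k≤m) (staged-all (suc m) k (ℕ.m≤n⇒m≤1+n k≤m))

  staged≈G : ∀ m i j → i ℕ.≤ m → j ℕ.≤ m → staged (suc m) m i j ≈ G (suc m) i j
  staged≈G m i j i≤m j≤m with ℕ.<-cmp j m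
  ... | tri< j<m _ _ rewrite dec-true (j <? m) j<m = begin
    (a when (i ≟ j) + - b when (i ℕ.+ j <? n)) + - 1# * (a when (i ≟ suc j) + - b when (i ℕ.+ suc j <? n))
      ≡⟨ ≡.cong (λ x → (a when (i ≟ j) + - b when (i ℕ.+ j <? n)) + - 1# * (a when (i ≟ suc j) + - b when (x <? n)))
                (ℕ.+-suc i j) ⟩
    (a when (i ≟ j) + - b when (i ℕ.+ j <? n)) + - 1# * (a when (i ≟ suc j) + - b when (suc (i ℕ.+ j) <? n))
      ≈⟨ solve 4 (λ x y z w → (x :+ :- y) :+ :- :1 :* (z :+ :- w) := x :+ :- z :+ :- (y :+ :- w)) refl _ _ _ _ ⟩
    a when (i ≟ j) + - a when (i ≟ suc j) + - (b when (i ℕ.+ j <? n) + - b when (suc (i ℕ.+ j) <? n))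
      ≈⟨ +-congˡ (-‿cong (when-<-difference b (i ℕ.+ j) n)) ⟩
    G n i j ∎
    where n = suc m
  ... | tri≈ _ ≡.refl _ rewrite dec-false (j <? j) (ℕ.<-irrefl ≡.refl) = begin
    a when (i ≟ j) + - b when (i ℕ.+ j <? suc j)
      ≈⟨ +-cong (solve 1 (λ x → x := x :+ :- :0) refl _) (-‿cong (b-corner i)) ⟩
    a when (i ≟ j) + - 0# + - b when (suc (i ℕ.+ j) ≟ suc j)
      ≈⟨ +-congʳ (+-congˡ (-‿cong (when-no a (i ≟ suc j) (ℕ.<⇒≢ (ℕ.s≤s i≤m))))) ⟨
    G (suc j) i j ∎
    where
    b-corner : ∀ i → b when (i ℕ.+ j <? suc j) ≈ b when (suc (i ℕ.+ j) ≟ suc j)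
    b-corner zero    = trans (when-yes b (j <? suc j) (ℕ.n<1+n j)) (sym (when-yes b (suc j ≟ suc j) ≡.refl))
    b-corner (suc i) = trans (when-no b (suc i ℕ.+ j <? suc j) (ℕ.≤⇒≯ (ℕ.s≤s (ℕ.m≤n+m j i))))
                             (sym (when-no b (suc (suc i ℕ.+ j) ≟ suc j) (ℕ.m≢1+n+m j ∘ ℕ.suc-injective ∘ ≡.sym)))
  ... | tri> _ _ m<j = contradiction j≤m (ℕ.<⇒≱ m<j)

  det-pencil : ∀ n → det n (matrix (pencil n)) ≈ detG n
  det-pencil zero    = refl
  det-pencil (suc m) = begin
    det (suc m) (matrix (pencil (suc m)))            ≈⟨ staged-all m m ℕ.≤-refl ⟨
    det (suc m) (matrix (staged (suc m) m))          ≈⟨ det-cong (suc m) (λ i j → staged≈G m (toℕ i) (toℕ j) (bound i) (bound j)) ⟩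
    detG (suc m)                                     ∎
    where
    bound : (i : Fin (suc m)) → toℕ i ℕ.≤ m
    bound i = ℕ.s≤s⁻¹ (toℕ<n i)

module FourTermRecurrence {c ℓ} (R : CommutativeRing c ℓ) where

  open import Data.Nat using (suc)
  open CommutativeRing R

  ≈-by-recurrence : ∀ (p q : Carrier) (u v : ℕ → Carrier) →
    (∀ t → u (suc (suc (suc (suc t)))) ≈ p * u (suc (suc t)) + - (q * u t)) →
    (∀ t → v (suc (suc (suc (suc t)))) ≈ p * v (suc (suc t)) + - (q * v t)) →
    u 0 ≈ v 0 → u 1 ≈ v 1 → u 2 ≈ v 2 → u 3 ≈ v 3 → ∀ n → u n ≈ v n
  ≈-by-recurrence p q u v u-rec v-rec u₀ u₁ u₂ u₃ = u≈v
    where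
    u≈v : ∀ n → u n ≈ v n
    u≈v 0 = u₀
    u≈v 1 = u₁
    u≈v 2 = u₂
    u≈v 3 = u₃
    u≈v (suc (suc (suc (suc t)))) =
      trans (u-rec t) (trans (+-cong (*-congˡ (u≈v (suc (suc t)))) (-‿cong (*-congˡ (u≈v t)))) (sym (v-rec t)))

module IntegerPolynomials where

  open import Data.Nat as ℕ using (ℕ; zero; suc; _∸_)
  import Data.Nat.Properties as ℕ
  open import Data.Integer as ℤ using (ℤ; +_)
  import Data.Integer.Properties as ℤ
  open import Data.Integer.Solver using (module +-*-Solver)
  open +-*-Solver using (solve; _:=_; _:+_)
  open import Data.Product using (_,_)
  open import Level using (0ℓ)
  open import Algebra.Bundles using (CommutativeRing)
  open import Algebra.Structures using (IsCommutativeRing)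
  import Algebra.Construct.Pointwise as Pointwise
  open import Relation.Binary.PropositionalEquality
  open ≡-Reasoning

  sumTo-cong : ∀ k {f g : ℕ → ℤ} → (∀ i → i ℕ.≤ k → f i ≡ g i) → sumTo k f ≡ sumTo k g
  sumTo-cong zero    f≡g = f≡g 0 ℕ.z≤n
  sumTo-cong (suc k) f≡g = cong₂ ℤ._+_ (sumTo-cong k λ i i≤k → f≡g i (ℕ.m≤n⇒m≤1+n i≤k)) (f≡g (suc k) ℕ.≤-refl)

  sumTo-cong′ : ∀ k {f g : ℕ → ℤ} → (∀ i → f i ≡ g i) → sumTo k f ≡ sumTo k g
  sumTo-cong′ k f≡g = sumTo-cong k λ i _ → f≡g i

  sumTo-zero : ∀ k (f : ℕ → ℤ) → (∀ i → f i ≡ + 0) → sumTo k f ≡ + 0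
  sumTo-zero zero    f f≡0 = f≡0 0
  sumTo-zero (suc k) f f≡0 = cong₂ ℤ._+_ (sumTo-zero k f f≡0) (f≡0 (suc k))

  sumTo-+ : ∀ k (f g : ℕ → ℤ) → sumTo k (λ i → f i ℤ.+ g i) ≡ sumTo k f ℤ.+ sumTo k g
  sumTo-+ zero    f g = refl
  sumTo-+ (suc k) f g = trans (cong (ℤ._+ (f (suc k) ℤ.+ g (suc k))) (sumTo-+ k f g))
    (solve 4 (λ a b c d → (a :+ b) :+ (c :+ d) := (a :+ c) :+ (b :+ d)) refl (sumTo k f) (sumTo k g) (f (suc k)) (g (suc k)))

  *-distribˡ-sumTo : ∀ k c (f : ℕ → ℤ) → c ℤ.* sumTo k f ≡ sumTo k (λ i → c ℤ.* f i)
  *-distribˡ-sumTo zero    c f = refl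
  *-distribˡ-sumTo (suc k) c f = trans (ℤ.*-distribˡ-+ c (sumTo k f) (f (suc k))) (cong (ℤ._+ (c ℤ.* f (suc k))) (*-distribˡ-sumTo k c f))

  *-distribʳ-sumTo : ∀ k c (f : ℕ → ℤ) → sumTo k f ℤ.* c ≡ sumTo k (λ i → f i ℤ.* c)
  *-distribʳ-sumTo zero    c f = refl
  *-distribʳ-sumTo (suc k) c f = trans (ℤ.*-distribʳ-+ c (sumTo k f) (f (suc k))) (cong (ℤ._+ (f (suc k) ℤ.* c)) (*-distribʳ-sumTo k c f))

  sumTo-head : ∀ k (f : ℕ → ℤ) → sumTo (suc k) f ≡ f 0 ℤ.+ sumTo k (λ i → f (suc i))
  sumTo-head zero    f = refl
  sumTo-head (suc k) f = trans (cong (ℤ._+ f (suc (suc k))) (sumTo-head k f)) (ℤ.+-assoc (f 0) (sumTo k (λ i → f (suc i))) (f (suc (suc k))))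

  sumTo-reverse : ∀ k (f : ℕ → ℤ) → sumTo k f ≡ sumTo k (λ i → f (k ∸ i))
  sumTo-reverse zero    f = refl
  sumTo-reverse (suc k) f = sym (begin
    sumTo (suc k) (λ i → f (suc k ∸ i))      ≡⟨ sumTo-head k (λ i → f (suc k ∸ i)) ⟩
    f (suc k) ℤ.+ sumTo k (λ i → f (k ∸ i))  ≡⟨ cong (λ s → f (suc k) ℤ.+ s) (sumTo-reverse k f) ⟨
    f (suc k) ℤ.+ sumTo k f                  ≡⟨ ℤ.+-comm (f (suc k)) (sumTo k f) ⟩
    sumTo k f ℤ.+ f (suc k)                  ∎)

  sumTo-triangle : ∀ k (f : ℕ → ℕ → ℤ) →
    sumTo k (λ m → sumTo m (λ i → f i m)) ≡ sumTo k (λ i → sumTo (k ∸ i) (λ j → f i (i ℕ.+ j)))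
  sumTo-triangle zero    f = refl
  sumTo-triangle (suc k) f = begin
    sumTo k (λ m → sumTo m (λ i → f i m)) ℤ.+ (sumTo k (λ i → f i (suc k)) ℤ.+ f (suc k) (suc k))
      ≡⟨ cong (ℤ._+ (sumTo k (λ i → f i (suc k)) ℤ.+ f (suc k) (suc k))) (sumTo-triangle k f) ⟩
    sumTo k (λ i → sumTo (k ∸ i) (row i)) ℤ.+ (sumTo k (λ i → f i (suc k)) ℤ.+ f (suc k) (suc k))
      ≡⟨ ℤ.+-assoc (sumTo k (λ i → sumTo (k ∸ i) (row i))) _ _ ⟨
    (sumTo k (λ i → sumTo (k ∸ i) (row i)) ℤ.+ sumTo k (λ i → f i (suc k))) ℤ.+ f (suc k) (suc k)
      ≡⟨ cong₂ ℤ._+_ (sym (sumTo-+ k _ _)) (sym last-row) ⟩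
    sumTo k (λ i → sumTo (k ∸ i) (row i) ℤ.+ f i (suc k)) ℤ.+ sumTo (suc k ∸ suc k) (row (suc k))
      ≡⟨ cong (ℤ._+ sumTo (suc k ∸ suc k) (row (suc k))) (sumTo-cong k extend-row) ⟩
    sumTo k (λ i → sumTo (suc k ∸ i) (row i)) ℤ.+ sumTo (suc k ∸ suc k) (row (suc k)) ∎
    where
    row : ℕ → ℕ → ℤ
    row i j = f i (i ℕ.+ j)
    last-row : sumTo (suc k ∸ suc k) (row (suc k)) ≡ f (suc k) (suc k)
    last-row = trans (cong (λ m → sumTo m (row (suc k))) (ℕ.n∸n≡0 k)) (cong (f (suc k)) (ℕ.+-identityʳ (suc k)))
    extend-row : ∀ i → i ℕ.≤ k → sumTo (k ∸ i) (row i) ℤ.+ f i (suc k) ≡ sumTo (suc k ∸ i) (row i)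
    extend-row i i≤k = sym (trans (cong (λ m → sumTo m (row i)) (ℕ.+-∸-assoc 1 i≤k))
      (cong (λ m → sumTo (k ∸ i) (row i) ℤ.+ f i m) (trans (ℕ.+-suc i (k ∸ i)) (cong suc (ℕ.m+[n∸m]≡n i≤k)))))

  1P : Poly
  1P = constP (+ 1)

  *P-cong : ∀ {p p′ q q′} → p ≈P p′ → q ≈P q′ → (p *P q) ≈P (p′ *P q′)
  *P-cong p≈p′ q≈q′ k = sumTo-cong′ k λ i → cong₂ ℤ._*_ (p≈p′ i) (q≈q′ (k ∸ i))

  *P-comm : ∀ p q → (p *P q) ≈P (q *P p)
  *P-comm p q k = trans (sumTo-reverse k _) (sumTo-cong k λ i i≤k →
    trans (cong (λ m → p (k ∸ i) ℤ.* q m) (ℕ.m∸[m∸n]≡n i≤k)) (ℤ.*-comm (p (k ∸ i)) (q i)))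

  *P-assoc : ∀ p q r → ((p *P q) *P r) ≈P (p *P (q *P r))
  *P-assoc p q r k = begin
    sumTo k (λ m → sumTo m (λ i → p i ℤ.* q (m ∸ i)) ℤ.* r (k ∸ m))
      ≡⟨ sumTo-cong′ k (λ m → *-distribʳ-sumTo m (r (k ∸ m)) _) ⟩
    sumTo k (λ m → sumTo m (λ i → p i ℤ.* q (m ∸ i) ℤ.* r (k ∸ m)))
      ≡⟨ sumTo-triangle k (λ i m → p i ℤ.* q (m ∸ i) ℤ.* r (k ∸ m)) ⟩
    sumTo k (λ i → sumTo (k ∸ i) (λ j → p i ℤ.* q (i ℕ.+ j ∸ i) ℤ.* r (k ∸ (i ℕ.+ j))))
      ≡⟨ sumTo-cong′ k (λ i → sumTo-cong′ (k ∸ i) λ j →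
           trans (cong₂ (λ x y → p i ℤ.* q x ℤ.* r y) (ℕ.m+n∸m≡n i j) (sym (ℕ.∸-+-assoc k i j)))
                 (ℤ.*-assoc (p i) (q j) (r (k ∸ i ∸ j)))) ⟩
    sumTo k (λ i → sumTo (k ∸ i) (λ j → p i ℤ.* (q j ℤ.* r (k ∸ i ∸ j))))
      ≡⟨ sumTo-cong′ k (λ i → *-distribˡ-sumTo (k ∸ i) (p i) _) ⟨
    sumTo k (λ i → p i ℤ.* sumTo (k ∸ i) (λ j → q j ℤ.* r (k ∸ i ∸ j))) ∎

  *P-identityˡ : ∀ p → (1P *P p) ≈P p
  *P-identityˡ p zero    = ℤ.*-identityˡ (p 0)
  *P-identityˡ p (suc k) = begin
    sumTo (suc k) (λ i → 1P i ℤ.* p (suc k ∸ i))               ≡⟨ sumTo-head k _ ⟩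
    1P 0 ℤ.* p (suc k) ℤ.+ sumTo k (λ i → + 0 ℤ.* p (k ∸ i))   ≡⟨ cong₂ ℤ._+_ (ℤ.*-identityˡ (p (suc k))) (sumTo-zero k _ λ _ → refl) ⟩
    p (suc k) ℤ.+ + 0                                          ≡⟨ ℤ.+-identityʳ (p (suc k)) ⟩
    p (suc k)                                                  ∎

  *P-distribʳ : ∀ p q r → ((q +P r) *P p) ≈P (q *P p +P r *P p)
  *P-distribʳ p q r k = trans (sumTo-cong′ k λ i → ℤ.*-distribʳ-+ (p (k ∸ i)) (q i) (r i)) (sumTo-+ k _ _)

  ℤ[x] : CommutativeRing 0ℓ 0ℓ
  ℤ[x] = record { isCommutativeRing = isCommutativeRing }
    where
    isCommutativeRing : IsCommutativeRing _≈P_ _+P_ _*P_ -P_ 0P 1P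
    isCommutativeRing = record
      { isRing = record
        { +-isAbelianGroup = Pointwise.isAbelianGroup ℕ ℤ.+-0-isAbelianGroup
        ; *-cong           = *P-cong
        ; *-assoc          = *P-assoc
        ; *-identity       = *P-identityˡ , λ p k → trans (*P-comm p 1P k) (*P-identityˡ p k)
        ; distrib          = (λ p q r k → trans (*P-comm p (q +P r) k)
                                 (trans (*P-distribʳ p q r k) (cong₂ ℤ._+_ (*P-comm q p k) (*P-comm r p k))))
                           , *P-distribʳ
        }
      ; *-comm = *P-comm
      }

  shift² : Poly → Poly
  shift² p zero          = + 0
  shift² p (suc zero)    = + 0
  shift² p (suc (suc k)) = p k

  X*-suc : ∀ p k → (X *P p) (suc k) ≡ p k
  X*-suc p k = begin
    (X *P p) (suc k)                                 ≡⟨ sumTo-head k _ ⟩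
    + 0 ℤ.+ sumTo k (λ i → X (suc i) ℤ.* p (k ∸ i))  ≡⟨ ℤ.+-identityˡ _ ⟩
    sumTo k (λ i → X (suc i) ℤ.* p (k ∸ i))          ≡⟨ sumTo-cong′ k (λ i → cong (ℤ._* p (k ∸ i)) (X-suc i)) ⟩
    (1P *P p) k                                      ≡⟨ *P-identityˡ p k ⟩
    p k                                              ∎
    where
    X-suc : ∀ i → X (suc i) ≡ 1P i
    X-suc zero    = refl
    X-suc (suc i) = refl

  X*X*≈shift² : ∀ p → (X *P (X *P p)) ≈P shift² p
  X*X*≈shift² p zero          = refl
  X*X*≈shift² p (suc zero)    = X*-suc (X *P p) 0
  X*X*≈shift² p (suc (suc k)) = trans (X*-suc (X *P p) (suc k)) (X*-suc p k)

module Degree where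

  open import Data.Bool using (true; false; if_then_else_)
  open import Data.Nat as ℕ using (zero; suc; _∸_; _≤?_)
  import Data.Nat.Properties as ℕ
  open import Data.Fin as Fin using (Fin; toℕ)
  open import Data.Integer as ℤ using (+_)
  import Data.Integer.Properties as ℤ
  open import Relation.Nullary using (yes; no)
  open import Relation.Binary.PropositionalEquality
  open IntegerPolynomials
  open Determinant ℤ[x]

  DegreeBelow : ℕ → Poly → Set
  DegreeBelow d p = ∀ i → d ≤ i → p i ≡ + 0

  degree-mono : ∀ {d d′ p} → d ≤ d′ → DegreeBelow d p → DegreeBelow d′ p
  degree-mono d≤d′ deg i d′≤i = deg i (ℕ.≤-trans d≤d′ d′≤i)

  degree-1P : DegreeBelow 1 1P
  degree-1P (suc i) _ = refl

  degree-X : DegreeBelow 2 X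
  degree-X (suc zero)    (ℕ.s≤s ())
  degree-X (suc (suc i)) _ = refl

  degree-0P : ∀ {d} → DegreeBelow d 0P
  degree-0P _ _ = refl

  degree-if : ∀ {d} β {p} → DegreeBelow d p → DegreeBelow d (if β then p else 0P)
  degree-if true  deg-p = deg-p
  degree-if false _     = degree-0P

  degree-+ : ∀ {d p q} → DegreeBelow d p → DegreeBelow d q → DegreeBelow d (p +P q)
  degree-+ deg-p deg-q i d≤i = cong₂ ℤ._+_ (deg-p i d≤i) (deg-q i d≤i)

  degree-neg : ∀ {d p} → DegreeBelow d p → DegreeBelow d (-P p)
  degree-neg deg-p i d≤i = cong ℤ.-_ (deg-p i d≤i)

  degree-* : ∀ {d e p q} → DegreeBelow (suc d) p → DegreeBelow (suc e) q → DegreeBelow (suc (d ℕ.+ e)) (p *P q)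
  degree-* {d} {e} {p} {q} deg-p deg-q i d+e<i = sumTo-zero i _ term≡0
    where
    term≡0 : ∀ j → p j ℤ.* q (i ∸ j) ≡ + 0
    term≡0 j with suc d ≤? j
    ... | yes d<j = trans (cong (ℤ._* q (i ∸ j)) (deg-p j d<j)) (ℤ.*-zeroˡ (q (i ∸ j)))
    ... | no d≮j  = trans (cong (p j ℤ.*_) (deg-q (i ∸ j) e<i-j)) (ℤ.*-zeroʳ (p j))
      where
      j+e<i : j ℕ.+ suc e ≤ i
      j+e<i = ℕ.≤-trans (ℕ.+-monoˡ-≤ (suc e) (ℕ.s≤s⁻¹ (ℕ.≰⇒> d≮j))) (subst (_≤ i) (sym (ℕ.+-suc d e)) d+e<i)
      e<i-j : suc e ≤ i ∸ j
      e<i-j = subst (_≤ i ∸ j) (ℕ.m+n∸m≡n j (suc e)) (ℕ.∸-monoˡ-≤ j j+e<i)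

  agree-below-4 : ∀ {p q} → DegreeBelow 4 p → DegreeBelow 4 q →
                  p 0 ≡ q 0 → p 1 ≡ q 1 → p 2 ≡ q 2 → p 3 ≡ q 3 → p ≈P q
  agree-below-4 deg-p deg-q e₀ e₁ e₂ e₃ 0 = e₀
  agree-below-4 deg-p deg-q e₀ e₁ e₂ e₃ 1 = e₁
  agree-below-4 deg-p deg-q e₀ e₁ e₂ e₃ 2 = e₂
  agree-below-4 deg-p deg-q e₀ e₁ e₂ e₃ 3 = e₃
  agree-below-4 deg-p deg-q e₀ e₁ e₂ e₃ i@(suc (suc (suc (suc _)))) =
    trans (deg-p i 4≤i) (sym (deg-q i 4≤i))
    where 4≤i = ℕ.s≤s (ℕ.s≤s (ℕ.s≤s (ℕ.s≤s ℕ.z≤n)))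

  degree-sum : ∀ {d n} (f : Fin n → Poly) → (∀ j → DegreeBelow d (f j)) → DegreeBelow d (sum f)
  degree-sum {n = zero}  f deg-f = degree-0P
  degree-sum {n = suc n} f deg-f = degree-+ (deg-f Fin.zero) (degree-sum (λ j → f (Fin.suc j)) (λ j → deg-f (Fin.suc j)))

  degree-sign : ∀ m → DegreeBelow 1 (sign m)
  degree-sign zero          = degree-1P
  degree-sign (suc zero)    = degree-neg degree-1P
  degree-sign (suc (suc m)) = degree-sign m

  det-degree : ∀ n (M : Matrix n) → (∀ i j → DegreeBelow 2 (M i j)) → DegreeBelow (suc n) (det n M)
  det-degree zero    M deg-M = degree-1P
  det-degree (suc n) M deg-M = degree-sum _ λ j →
    degree-* (degree-* (degree-sign (toℕ j)) (deg-M Fin.zero j)) (det-degree n (minor j M) λ i k → deg-M (Fin.suc i) _)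

module Coefficients where

  open import Data.Nat as ℕ using (ℕ; zero; suc; ⌊_/2⌋; _≤?_)
  import Data.Nat.Properties as ℕ
  open import Data.Nat.Combinatorics using (_C_; k>n⇒nCk≡0; nC1≡n; nCk+nC[k+1]≡[n+1]C[k+1])
  open import Data.Integer as ℤ using (ℤ; +_)
  import Data.Integer.Properties as ℤ
  open import Data.Integer.Solver using (module +-*-Solver)
  open +-*-Solver using (solve; _:=_; _:+_; _:*_; :-_; con)
  open import Relation.Nullary using (yes; no)
  open import Relation.Nullary.Decidable using (dec-true; dec-false)
  open import Relation.Binary.PropositionalEquality
  open ≡-Reasoning
  open IntegerPolynomials
  open Degree using (DegreeBelow)

  sgn-suc : ∀ m → sgn (suc m) ≡ ℤ.- sgn m
  sgn-suc zero          = refl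
  sgn-suc (suc zero)    = refl
  sgn-suc (suc (suc m)) = sgn-suc m

  ⌊/2⌋-< : ∀ m k → m ℕ.< k ℕ.+ k → ⌊ m /2⌋ ℕ.< k
  ⌊/2⌋-< zero          (suc k) _ = ℕ.s≤s ℕ.z≤n
  ⌊/2⌋-< (suc zero)    (suc k) _ = ℕ.s≤s ℕ.z≤n
  ⌊/2⌋-< (suc (suc m)) (suc k) (ℕ.s≤s m+1<k+k+1) =
    ℕ.s≤s (⌊/2⌋-< m k (ℕ.s≤s⁻¹ (subst (suc (suc m) ℕ.≤_) (ℕ.+-suc k k) m+1<k+k+1)))

  coeff-degree : ∀ n → DegreeBelow (suc n) (coeff n)
  coeff-degree n k n<k = trans (cong (λ c → sgn ⌊ 3 ℕ.* k /2⌋ ℤ.* + c) (k>n⇒nCk≡0 (⌊/2⌋-< (n ℕ.+ k) k (ℕ.+-monoˡ-< k n<k))))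
                               (ℤ.*-zeroʳ (sgn ⌊ 3 ℕ.* k /2⌋))

  P≈coeff : ∀ n → P n ≈P coeff n
  P≈coeff n k with k ≤? n
  ... | yes k≤n rewrite dec-true (k ≤? n) k≤n = refl
  ... | no k≰n  rewrite dec-false (k ≤? n) k≰n = sym (coeff-degree n k (ℕ.≰⇒> k≰n))

  coeff-1 : ∀ n → coeff n 1 ≡ ℤ.- + ⌊ suc n /2⌋
  coeff-1 n = trans (cong (λ c → ℤ.- + 1 ℤ.* + c) (trans (nC1≡n _) (cong ⌊_/2⌋ (ℕ.+-comm n 1)))) (ℤ.-1*i≡-i _)

  coeff-2+ : ∀ n k → coeff n (suc (suc k)) ≡ ℤ.- (sgn ⌊ 3 ℕ.* k /2⌋ ℤ.* + (⌊ n ℕ.+ suc (suc k) /2⌋ C suc (suc k)))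
  coeff-2+ n k = begin
    sgn ⌊ 3 ℕ.* suc (suc k) /2⌋ ℤ.* + B  ≡⟨ cong (λ m → sgn ⌊ m /2⌋ ℤ.* + B) (ℕ.*-distribˡ-+ 3 2 k) ⟩
    sgn (suc ⌊ 3 ℕ.* k /2⌋) ℤ.* + B       ≡⟨ cong (ℤ._* + B) (sgn-suc ⌊ 3 ℕ.* k /2⌋) ⟩
    ℤ.- sgn ⌊ 3 ℕ.* k /2⌋ ℤ.* + B         ≡⟨ ℤ.neg-distribˡ-* (sgn ⌊ 3 ℕ.* k /2⌋) (+ B) ⟨
    ℤ.- (sgn ⌊ 3 ℕ.* k /2⌋ ℤ.* + B)       ∎
    where B = ⌊ n ℕ.+ suc (suc k) /2⌋ C suc (suc k)

  coeff-rec-at : ∀ t k → coeff (suc (suc (suc (suc t)))) k ≡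
    coeff (suc (suc t)) k ℤ.+ coeff (suc (suc t)) k ℤ.+ ℤ.- shift² (coeff (suc (suc t))) k ℤ.+ ℤ.- coeff t k
  coeff-rec-at t zero = refl
  coeff-rec-at t (suc zero) rewrite coeff-1 (suc (suc (suc (suc t)))) | coeff-1 (suc (suc t)) | coeff-1 t =
    solve 1 (λ m → :- (con (+ 1) :+ (con (+ 1) :+ m)) := :- (con (+ 1) :+ m) :+ :- (con (+ 1) :+ m) :+ :- con (+ 0) :+ :- (:- m))
          refl (+ ⌊ suc t /2⌋)
  coeff-rec-at t (suc (suc k)) = begin
    coeff (suc (suc (suc (suc t)))) (suc (suc k))
      ≡⟨ coeff-2+ (suc (suc (suc (suc t)))) k ⟩
    ℤ.- (s ℤ.* + (suc (suc ⌊ t ℕ.+ suc (suc k) /2⌋) C suc (suc k)))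
      ≡⟨ cong (λ m → ℤ.- (s ℤ.* + (suc (suc m) C suc (suc k)))) half ⟩
    ℤ.- (s ℤ.* + (suc (suc (suc N)) C suc (suc k)))
      ≡⟨ cong (λ x → ℤ.- (s ℤ.* x)) pascal² ⟩
    ℤ.- (s ℤ.* ((+ b₀ ℤ.+ + b₁) ℤ.+ (+ b₁ ℤ.+ + b₂)))
      ≡⟨ solve 4 (λ s b₀ b₁ b₂ → :- (s :* ((b₀ :+ b₁) :+ (b₁ :+ b₂)))
                            := :- (s :* (b₁ :+ b₂)) :+ :- (s :* (b₁ :+ b₂)) :+ :- (s :* b₀) :+ :- (:- (s :* b₂)))
                 refl s (+ b₀) (+ b₁) (+ b₂) ⟩
    ℤ.- (s ℤ.* (+ b₁ ℤ.+ + b₂)) ℤ.+ ℤ.- (s ℤ.* (+ b₁ ℤ.+ + b₂)) ℤ.+ ℤ.- (s ℤ.* + b₀) ℤ.+ ℤ.- (ℤ.- (s ℤ.* + b₂))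
      ≡⟨ cong₂ ℤ._+_ (cong₂ ℤ._+_ (cong₂ ℤ._+_ middle middle) refl) (cong ℤ.-_ low) ⟨
    coeff (suc (suc t)) (suc (suc k)) ℤ.+ coeff (suc (suc t)) (suc (suc k))
      ℤ.+ ℤ.- coeff (suc (suc t)) k ℤ.+ ℤ.- coeff t (suc (suc k)) ∎
    where
    s = sgn ⌊ 3 ℕ.* k /2⌋
    N = ⌊ t ℕ.+ k /2⌋
    half : ⌊ t ℕ.+ suc (suc k) /2⌋ ≡ suc N
    half = cong ⌊_/2⌋ (trans (ℕ.+-suc t (suc k)) (cong suc (ℕ.+-suc t k)))
    b₀ = suc N C k
    b₁ = suc N C suc k
    b₂ = suc N C suc (suc k)
    pascal : + (suc (suc N) C suc (suc k)) ≡ + b₁ ℤ.+ + b₂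
    pascal = trans (cong +_ (sym (nCk+nC[k+1]≡[n+1]C[k+1] (suc N) (suc k)))) (ℤ.pos-+ b₁ b₂)
    pascal² : + (suc (suc (suc N)) C suc (suc k)) ≡ (+ b₀ ℤ.+ + b₁) ℤ.+ (+ b₁ ℤ.+ + b₂)
    pascal² = trans (cong +_ (sym (nCk+nC[k+1]≡[n+1]C[k+1] (suc (suc N)) (suc k))))
               (trans (ℤ.pos-+ (suc (suc N) C suc k) (suc (suc N) C suc (suc k)))
                      (cong₂ ℤ._+_ (trans (cong +_ (sym (nCk+nC[k+1]≡[n+1]C[k+1] (suc N) k))) (ℤ.pos-+ b₀ b₁)) pascal))
    middle : coeff (suc (suc t)) (suc (suc k)) ≡ ℤ.- (s ℤ.* (+ b₁ ℤ.+ + b₂))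
    middle = trans (coeff-2+ (suc (suc t)) k) (cong (λ x → ℤ.- (s ℤ.* x)) (trans (cong (λ m → + (suc m C suc (suc k))) half) pascal))
    low : coeff t (suc (suc k)) ≡ ℤ.- (s ℤ.* + b₂)
    low = trans (coeff-2+ t k) (cong (λ m → ℤ.- (s ℤ.* + (m C suc (suc k)))) half)

  coeff-rec : ∀ t → coeff (suc (suc (suc (suc t)))) ≈P
    (coeff (suc (suc t)) +P coeff (suc (suc t)) -P X *P (X *P coeff (suc (suc t))) -P coeff t)
  coeff-rec t k = trans (coeff-rec-at t k)
    (cong (λ s → coeff (suc (suc t)) k ℤ.+ coeff (suc (suc t)) k ℤ.+ ℤ.- s ℤ.+ ℤ.- coeff t k) (sym (X*X*≈shift² _ k)))

module Reversal where

  open import Data.Nat as ℕ using (zero; suc; _∸_; _≤?_)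
  import Data.Nat.Properties as ℕ
  open import Data.Integer using (ℤ; +_)
  open import Data.Bool using (true; false; if_then_else_)
  open import Relation.Nullary using (does; yes; no)
  open import Relation.Nullary.Decidable using (dec-true; dec-false)
  open import Relation.Binary.PropositionalEquality
  open import Function using (_∘_)
  open IntegerPolynomials
  open Degree using (DegreeBelow)

  -- x^n p(1/x), for p of degree at most n
  reverse : ℕ → Poly → Poly
  reverse n p m = if does (m ≤? n) then p (n ∸ m) else + 0

  private
    if-zero : ∀ β {x : ℤ} → x ≡ + 0 → (if β then x else + 0) ≡ + 0
    if-zero true  x≡0 = x≡0
    if-zero false _   = refl

  reverse-degree : ∀ n p → DegreeBelow (suc n) (reverse n p)
  reverse-degree n p m n<m rewrite dec-false (m ≤? n) (ℕ.<⇒≱ n<m) = refl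

  reverse-cong : ∀ n {p q} → p ≈P q → reverse n p ≈P reverse n q
  reverse-cong n p≈q m = cong (if does (m ≤? n) then_else + 0) (p≈q (n ∸ m))

  reverse-+ : ∀ n p q → reverse n (p +P q) ≈P (reverse n p +P reverse n q)
  reverse-+ n p q m with does (m ≤? n)
  ... | true  = refl
  ... | false = refl

  reverse-neg : ∀ n p → reverse n (-P p) ≈P (-P reverse n p)
  reverse-neg n p m with does (m ≤? n)
  ... | true  = refl
  ... | false = refl

  reverse-shift² : ∀ n p → reverse (suc (suc n)) (shift² p) ≈P reverse n p
  reverse-shift² n p m with m ≤? n
  ... | yes m≤n rewrite dec-true (m ≤? suc (suc n)) (ℕ.m≤n⇒m≤o+n 2 m≤n) | dec-true (m ≤? n) m≤n =
    cong (shift² p) (ℕ.+-∸-assoc 2 m≤n)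
  ... | no m≰n rewrite dec-false (m ≤? n) m≰n = if-zero (does (m ≤? suc (suc n))) (low-zero (suc (suc n) ∸ m) small)
    where
    small : suc (suc n) ∸ m ℕ.< 2
    small = ℕ.s≤s (ℕ.≤-trans (ℕ.∸-monoʳ-≤ (suc (suc n)) (ℕ.≰⇒> m≰n)) (ℕ.≤-reflexive (ℕ.m+n∸n≡m 1 n)))
    low-zero : ∀ k → k ℕ.< 2 → shift² p k ≡ + 0
    low-zero zero          _ = refl
    low-zero (suc zero)    _ = refl
    low-zero (suc (suc k)) (ℕ.s≤s (ℕ.s≤s ()))

  reverse-lift : ∀ n p → DegreeBelow (suc n) p → reverse (suc (suc n)) p ≈P shift² (reverse n p)
  reverse-lift n p deg zero          = deg (suc (suc n)) (ℕ.n≤1+n (suc n))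
  reverse-lift n p deg (suc zero)    = deg (suc n) ℕ.≤-refl
  reverse-lift n p deg (suc (suc m)) with m ≤? n
  ... | yes m≤n rewrite dec-true (m ≤? n) m≤n | dec-true (suc (suc m) ≤? suc (suc n)) (ℕ.s≤s (ℕ.s≤s m≤n)) = refl
  ... | no m≰n  rewrite dec-false (m ≤? n) m≰n | dec-false (suc (suc m) ≤? suc (suc n)) (m≰n ∘ ℕ.s≤s⁻¹ ∘ ℕ.s≤s⁻¹) = refl

module Corollary where

  open import Data.Nat as ℕ using (zero; suc)
  import Data.Nat.Properties as ℕ
  open import Data.Fin using (Fin; zero; suc; toℕ)
  open import Data.Integer as ℤ using (+_)
  open import Data.Bool using (true; false; if_then_else_)
  open import Function using (_∘_)
  open import Relation.Nullary using (does)
  import Relation.Binary.PropositionalEquality as ≡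
  open ≡ using (_≡_)
  open IntegerPolynomials
  open Coefficients
  open Degree
  open Reversal
  open CommutativeRing ℤ[x] using (refl; sym; trans; +-cong; -‿cong; *-cong; *-congˡ; *-identityʳ; zeroʳ; setoid)
  open import Relation.Binary.Reasoning.Setoid setoid
  open Determinant ℤ[x] using (det; sum; sum-cong-≋; sign; minor; det-cong)
  open IntegerCoefficients ℤ[x] using (solve; _:=_; _:+_; _:*_; :-_; :1)
  open FourTermRecurrence ℤ[x] using (≈-by-recurrence)
  module F₁ = Pencil ℤ[x] 1P X
  module F₂ = Pencil ℤ[x] X 1P

  sumFinP≈sum : ∀ {n} (f : Fin n → Poly) → sumFinP f ≈P sum f
  sumFinP≈sum {zero}  f k = ≡.refl
  sumFinP≈sum {suc n} f k = ≡.cong (λ s → f zero k ℤ.+ s) (sumFinP≈sum (f ∘ suc) k)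

  constP-sgn : ∀ m → constP (sgn m) ≈P sign m
  constP-sgn zero                = refl
  constP-sgn (suc zero) zero     = ≡.refl
  constP-sgn (suc zero) (suc k)  = ≡.refl
  constP-sgn (suc (suc m))       = constP-sgn m

  detP≈det : ∀ n M → detP n M ≈P det n M
  detP≈det zero    M = refl
  detP≈det (suc n) M = trans (sumFinP≈sum λ j → constP (sgn (toℕ j)) *P M zero j *P detP n (minor j M)) (sum-cong-≋ λ j →
    *-cong (*-cong (constP-sgn (toℕ j)) (refl {M zero j})) (detP≈det n (minor j M)))

  constP-if : ∀ β → constP (if β then + 1 else + 0) ≈P (if β then 1P else 0P)
  constP-if true  k       = ≡.refl
  constP-if false zero    = ≡.refl
  constP-if false (suc k) = ≡.refl

  X*constP-if : ∀ β → (X *P constP (if β then + 1 else + 0)) ≈P (if β then X else 0P)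
  X*constP-if true  = trans (*-congˡ {X} (constP-if true)) (*-identityʳ X)
  X*constP-if false = trans (*-congˡ {X} (constP-if false)) (zeroʳ X)

  detP-I-xA : ∀ n → detP n (I-xA n) ≈P F₁.detG n
  detP-I-xA n = begin
    detP n (I-xA n)                       ≈⟨ detP≈det n (I-xA n) ⟩
    det n (I-xA n)                        ≈⟨ det-cong n (λ i j → +-cong (constP-if _) (-‿cong (X*constP-if _))) ⟩
    det n (F₁.matrix (F₁.pencil n))       ≈⟨ F₁.det-pencil n ⟩
    F₁.detG n                             ∎

  detP-xI-A : ∀ n → detP n (xI-A n) ≈P F₂.detG n
  detP-xI-A n = begin
    detP n (xI-A n)                       ≈⟨ detP≈det n (xI-A n) ⟩
    det n (xI-A n)                        ≈⟨ det-cong n (λ i j → +-cong (X*constP-if _) (-‿cong (constP-if _))) ⟩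
    det n (F₂.matrix (F₂.pencil n))       ≈⟨ F₂.det-pencil n ⟩
    F₂.detG n                             ∎

  -- stated in the shape of F₁.detG-rec₄ (resp. F₂.detG-rec₄ below), as ≈-by-recurrence requires
  coeff-pencil-rec : ∀ t → coeff (suc (suc (suc (suc t)))) ≈P
    ((1P *P 1P +P 1P *P 1P +P -P (X *P X)) *P coeff (suc (suc t)) +P -P (1P *P 1P *P (1P *P 1P) *P coeff t))
  coeff-pencil-rec t = trans (coeff-rec t)
    (solve 3 (λ x p q → p :+ p :+ :- (x :* (x :* p)) :+ :- q
                    := (:1 :* :1 :+ :1 :* :1 :+ :- (x :* x)) :* p :+ :- (:1 :* :1 :* (:1 :* :1) :* q))
           refl X (coeff (suc (suc t))) (coeff t))

  Prev-pencil-rec : ∀ t → Prev (suc (suc (suc (suc t)))) ≈P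
    ((X *P X +P X *P X +P -P (1P *P 1P)) *P Prev (suc (suc t)) +P -P (X *P X *P (X *P X) *P Prev t))
  Prev-pencil-rec t = begin
    reverse (4+ t) (coeff (4+ t))
      ≈⟨ reverse-cong (4+ t) (coeff-rec t) ⟩
    reverse (4+ t) (c₂ +P c₂ -P X *P (X *P c₂) -P c₀)
      ≈⟨ trans (reverse-+ (4+ t) (c₂ +P c₂ -P X²c₂) (-P c₀))
               (+-cong (trans (reverse-+ (4+ t) (c₂ +P c₂) (-P X²c₂)) (+-cong (reverse-+ (4+ t) c₂ c₂) (reverse-neg (4+ t) X²c₂)))
                       (reverse-neg (4+ t) c₀)) ⟩
    reverse (4+ t) c₂ +P reverse (4+ t) c₂ -P reverse (4+ t) (X *P (X *P c₂)) -P reverse (4+ t) c₀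
      ≈⟨ +-cong (+-cong (+-cong lift-c₂ lift-c₂) (-‿cong drop-X²)) (-‿cong lift-c₀) ⟩
    X *P (X *P Prev (2+ t)) +P X *P (X *P Prev (2+ t)) -P Prev (2+ t) -P X *P (X *P (X *P (X *P Prev t)))
      ≈⟨ solve 3 (λ x p q → x :* (x :* p) :+ x :* (x :* p) :+ :- p :+ :- (x :* (x :* (x :* (x :* q))))
                      := (x :* x :+ x :* x :+ :- (:1 :* :1)) :* p :+ :- (x :* x :* (x :* x) :* q))
                 refl X (Prev (2+ t)) (Prev t) ⟩
    (X *P X +P X *P X +P -P (1P *P 1P)) *P Prev (2+ t) +P -P (X *P X *P (X *P X) *P Prev t) ∎
    where
    2+ 4+ : ℕ → ℕ
    2+ n = suc (suc n)
    4+ n = suc (suc (suc (suc n)))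
    c₂ = coeff (2+ t)
    c₀ = coeff t
    X²c₂ = X *P (X *P c₂)
    deg : ∀ {n d} → n ℕ.< d → DegreeBelow d (coeff n)
    deg {n} n<d = degree-mono n<d (coeff-degree n)
    lift-c₂ : reverse (4+ t) c₂ ≈P (X *P (X *P Prev (2+ t)))
    lift-c₂ = trans (reverse-lift (2+ t) c₂ (deg (ℕ.n<1+n (2+ t)))) (sym (X*X*≈shift² (Prev (2+ t))))
    drop-X² : reverse (4+ t) (X *P (X *P c₂)) ≈P Prev (2+ t)
    drop-X² = trans (reverse-cong (4+ t) (X*X*≈shift² c₂)) (reverse-shift² (2+ t) c₂)
    lift-c₀ : reverse (4+ t) c₀ ≈P (X *P (X *P (X *P (X *P Prev t))))
    lift-c₀ = begin
      reverse (4+ t) c₀                  ≈⟨ reverse-lift (2+ t) c₀ (deg (ℕ.m<n+m t (ℕ.s≤s ℕ.z≤n))) ⟩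
      shift² (reverse (2+ t) c₀)         ≈⟨ X*X*≈shift² _ ⟨
      X *P (X *P reverse (2+ t) c₀)      ≈⟨ *-congˡ {X} (*-congˡ {X} (reverse-lift t c₀ (deg (ℕ.n<1+n t)))) ⟩
      X *P (X *P shift² (Prev t))        ≈⟨ *-congˡ {X} (*-congˡ {X} (X*X*≈shift² (Prev t))) ⟨
      X *P (X *P (X *P (X *P Prev t)))   ∎

  detG-degree : ∀ {a b} → DegreeBelow 2 a → DegreeBelow 2 b → ∀ n → DegreeBelow (suc n) (Pencil.detG ℤ[x] a b n)
  detG-degree deg-a deg-b n = det-degree n _ λ i j →
    degree-+ (degree-+ (degree-if (does (toℕ i ℕ.≟ toℕ j)) deg-a) (degree-neg (degree-if (does (toℕ i ℕ.≟ suc (toℕ j))) deg-a)))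
             (degree-neg (degree-if (does (suc (toℕ i ℕ.+ toℕ j) ℕ.≟ n)) deg-b))

  coeff≈detG : ∀ n → coeff n ≈P F₁.detG n
  coeff≈detG = ≈-by-recurrence (1P *P 1P +P 1P *P 1P +P -P (X *P X)) (1P *P 1P *P (1P *P 1P)) coeff F₁.detG coeff-pencil-rec F₁.detG-rec₄
    (base 0 ℕ.z≤n ≡.refl ≡.refl ≡.refl ≡.refl) (base 1 (ℕ.s≤s ℕ.z≤n) ≡.refl ≡.refl ≡.refl ≡.refl)
    (base 2 (ℕ.s≤s (ℕ.s≤s ℕ.z≤n)) ≡.refl ≡.refl ≡.refl ≡.refl) (base 3 ℕ.≤-refl ≡.refl ≡.refl ≡.refl ≡.refl)
    where
    base : ∀ m → m ℕ.≤ 3 → coeff m 0 ≡ F₁.detG m 0 → coeff m 1 ≡ F₁.detG m 1 →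
           coeff m 2 ≡ F₁.detG m 2 → coeff m 3 ≡ F₁.detG m 3 → coeff m ≈P F₁.detG m
    base m m≤3 = agree-below-4 (degree-mono (ℕ.s≤s m≤3) (coeff-degree m))
                               (degree-mono (ℕ.s≤s m≤3) (detG-degree (degree-mono (ℕ.s≤s ℕ.z≤n) degree-1P) degree-X m))

  detG≈Prev : ∀ n → F₂.detG n ≈P Prev n
  detG≈Prev = ≈-by-recurrence (X *P X +P X *P X +P -P (1P *P 1P)) (X *P X *P (X *P X)) F₂.detG Prev F₂.detG-rec₄ Prev-pencil-rec
    (base 0 ℕ.z≤n ≡.refl ≡.refl ≡.refl ≡.refl) (base 1 (ℕ.s≤s ℕ.z≤n) ≡.refl ≡.refl ≡.refl ≡.refl)
    (base 2 (ℕ.s≤s (ℕ.s≤s ℕ.z≤n)) ≡.refl ≡.refl ≡.refl ≡.refl) (base 3 ℕ.≤-refl ≡.refl ≡.refl ≡.refl ≡.refl)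
    where
    base : ∀ m → m ℕ.≤ 3 → F₂.detG m 0 ≡ Prev m 0 → F₂.detG m 1 ≡ Prev m 1 →
           F₂.detG m 2 ≡ Prev m 2 → F₂.detG m 3 ≡ Prev m 3 → F₂.detG m ≈P Prev m
    base m m≤3 = agree-below-4 (degree-mono (ℕ.s≤s m≤3) (detG-degree degree-X (degree-mono (ℕ.s≤s ℕ.z≤n) degree-1P) m))
                               (degree-mono (ℕ.s≤s m≤3) (reverse-degree m (coeff m)))

open import Data.Product using (_×_; _,_)

-- The identities hold for n = 0 as well.
corollary4p7 : (n : ℕ) → 1 ≤ n →
    (P n ≈P detP n (I-xA n)) × (detP n (xI-A n) ≈P Prev n)
corollary4p7 n _ = P≈detP , detP≈Prev
  where
  open Corollary
  open IntegerPolynomials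
  open Coefficients using (P≈coeff)
  open import Relation.Binary.Reasoning.Setoid (CommutativeRing.setoid ℤ[x])
  P≈detP : P n ≈P detP n (I-xA n)
  P≈detP = begin
    P n              ≈⟨ P≈coeff n ⟩
    coeff n          ≈⟨ coeff≈detG n ⟩
    F₁.detG n        ≈⟨ detP-I-xA n ⟨
    detP n (I-xA n)  ∎
  detP≈Prev : detP n (xI-A n) ≈P Prev n
  detP≈Prev = begin
    detP n (xI-A n)  ≈⟨ detP-xI-A n ⟩
    F₂.detG n        ≈⟨ detG≈Prev n ⟩
    Prev n           ∎
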